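{- Let $G$ be a finite group, $N\le G$, and $\mathcal{L}=\{X_\alpha:\alpha\in W\}$ a closed linked system of semiregular relative difference sets in $G$ with forbidden subgroup $N$, parameters $(n\lambda,n,n\lambda,\lambda,w,\mu,\nu)$ and pair of characteristic functions $(\chi,\psi)$. Let $U$ be a group and $\varphi:U\to W^\infty$ a group isomorphism onto the associated group of $\mathcal{L}$. In $G\times U$ define $$T_0=\{e\},\ T_1=N\setminus\{e\},\ T_2=G\setminus N,\ T_3=\bigcup_{u\in U\setminus\{e\}}uX_{\varphi(u)},\ T_4=\bigcup_{u\in U\setminus\{e\}}u(G\setminus X_{\varphi(u)}).$$ Then $\mathcal{A}=\mathrm{Span}_{\mathbb{Z}}\{\underline{T_0},\dots,\underline{T_4}\}$ is a Higmanian $S$-ring over $G\times U$ with parameters $(w+1,\,n\lambda,\,n,\,n\lambda(n-1),\,(n-1)(w-1)\nu)$.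
   Context: For a finite group $H$ with identity $e$ and $X\subseteq H$, $\underline X=\sum_{x\in X}x\in\mathbb{Z}H$ and $X^{(-1)}=\{x^{ -1}:x\in X\}$. In $G\times U$, $G$ and $U$ are identified with their canonical copies, and $uX=\{ux:x\in X\}$. A relative difference set (RDS) in $G$ with forbidden subgroup $N$ and parameters $(m,n,k,\lambda)$ ($|G|=mn$, $|N|=n$) is a $k$-subset $X$ with $\underline X\,\underline{X^{(-1)}}=ke+\lambda\,\underline{G\setminus N}$; it is semiregular if $k=m$. A collection $\mathcal{L}=\{X_\alpha:\alpha\in W\}$ of RDSs in $G$ with the same forbidden subgroup $N$ and parameters $(m,n,k,\lambda)$, indexed by a finite set $W$ with $|W|=w\ge2$, is a closed linked system with parameters $(m,n,k,\lambda,w,\mu,\nu)$ and pair of characteristic functions $(\chi,\psi)$ if $\chi:W\to W$ is a bijection, $\psi:(W\times W)\setminus\{(\alpha,\chi(\alpha)):\alpha\in W\}\to W$, $\mu,\nu$ are nonnegative integers, $X_\alpha^{(-1)}=X_{\chi(\alpha)}$, and for all $\alpha,\beta\in W$: $\underline{X_\alpha}\,\underline{X_\beta}=ke+\lambda\underline{G\setminus N}$ if $\beta=\chi(\alpha)$, and $\underline{X_\alpha}\,\underline{X_\beta}=\mu\underline{X_{\psi(\alpha,\beta)}}+\nu\underline{G\setminus X_{\psi(\alpha,\beta)}}$ otherwise. For a closed linked system of semiregular RDSs, the associated group is the set $W^\infty=W\cup\{\infty\}$ with identity $\infty$, inversion $\hat\chi$ ($\hat\chi(\alpha)=\chi(\alpha)$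 for $\alpha\in W$, $\hat\chi(\infty)=\infty$) and multiplication $\hat\psi$ given by $\hat\psi(\alpha,\beta)=\psi(\alpha,\beta)$ if $\alpha,\beta\ne\infty$ and $\beta\ne\chi(\alpha)$; $\hat\psi(\alpha,\beta)=\infty$ if $\beta=\hat\chi(\alpha)$; $\hat\psi(\alpha,\infty)=\alpha$; $\hat\psi(\infty,\beta)=\beta$ (this is a group). An $S$-ring over a finite group $H$ is a subring $\mathcal{A}=\mathrm{Span}_{\mathbb{Z}}\{\underline X:X\in\mathcal S\}$ of $\mathbb{Z}H$ for a partition $\mathcal S$ of $H$ with $\{e\}\in\mathcal S$ and $X^{(-1)}\in\mathcal S$ for $X\in\mathcal S$; structure constants $p_{XY}^Z$ are given by $\underline X\,\underline Y=\sum_Zp_{XY}^Z\underline Z$. $\mathcal{A}$ is Higmanian if it is symmetric ($X^{(-1)}=X$ for all basic sets), of rank $|\mathcal S|=5$, and $H$ has proper nontrivial subgroups $L<K$ with $\underline L,\underline K\in\mathcal{A}$ such that the restriction $\mathcal{A}_L$ and quotient $\mathcal{A}_{H/K}$ have rank $2$ and the quotient $\mathcal{A}_{H/L}$ and restriction $\mathcal{A}_K$ have rank $3$. Its parameters are $(|H:K|,|K:L|,|L|,k,t)$ where $k=|X\cap Kg|$ (independent of $g\notin K$) and $t=p_{YX}^Y$ for the two basic sets $X,Y$ outside $K$ with $|Y|\le|X|$. -}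

module Defs where

open import Level using (0ℓ)
open import Data.Bool using (Bool; true; false; if_then_else_; not; _∧_; _∨_)
open import Data.Nat using (ℕ; zero; suc)
open import Data.Integer using (ℤ; +_; _+_; _*_)
open import Data.Fin using (Fin)
import Data.Fin as Fin
open import Data.Maybe using (Maybe; just; nothing)
open import Data.Product using (_×_; _,_; proj₁; proj₂; Σ; ∃)
open import Data.List using (List; []; _∷_; cartesianProduct)
open import Data.List.Membership.Propositional using (_∈_)
open import Data.List.Membership.Propositional.Properties using (∈-cartesianProduct⁺)
open import Data.List.Relation.Unary.Unique.Propositional using (Unique)
open import Data.List.Relation.Unary.Unique.Propositional.Properties using (cartesianProduct⁺)
open import Relation.Binary.PropositionalEquality
  using (_≡_; _≢_; refl; cong₂; isEquivalence)
open import Relation.Binary.Definitions using (DecidableEquality)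
open import Relation.Nullary using (yes; no; ¬_)
open import Relation.Nullary.Decidable using (⌊_⌋)

import Algebra.Structures as AS
open import Function.Definitions using (Bijective)

record FinGroup : Set₁ where
  infixl 7 _∙_
  field
    Carrier  : Set
    _≟_      : DecidableEquality Carrier
    _∙_      : Carrier → Carrier → Carrier
    e        : Carrier
    _⁻¹      : Carrier → Carrier
    isGroup  : AS.IsGroup {A = Carrier} _≡_ _∙_ e _⁻¹
    elems    : List Carrier
    complete : ∀ x → x ∈ elems
    unique   : Unique elems

module _ (G U : FinGroup) where
  private
    module G = FinGroup G
    module U = FinGroup U
    module IG = AS.IsGroup G.isGroup
    module IU = AS.IsGroup U.isGroup
    C = G.Carrier × U.Carrier
    _·_ : C → C → C
    (a , b) · (c , d) = (a G.∙ c , b U.∙ d)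
    ε : C
    ε = (G.e , U.e)
    inv : C → C
    inv (a , b) = (a G.⁻¹ , b U.⁻¹)
    deq : DecidableEquality C
    deq (a , b) (c , d) with G._≟_ a c | U._≟_ b d
    ... | yes refl | yes refl = yes refl
    ... | no p     | _        = no λ { refl → p refl }
    ... | yes _    | no q     = no λ { refl → q refl }
    isG : AS.IsGroup {A = C} _≡_ _·_ ε inv
    isG = record
      { isMonoid = record
        { isSemigroup = record
          { isMagma = record { isEquivalence = isEquivalence ; ∙-cong = cong₂ _·_ }
          ; assoc = λ { (a , b) (c , d) (f , g) → cong₂ _,_ (IG.assoc a c f) (IU.assoc b d g) } }
        ; identity = (λ { (a , b) → cong₂ _,_ (proj₁ IG.identity a) (proj₁ IU.identity b) })
                   , (λ { (a , b) → cong₂ _,_ (proj₂ IG.identity a) (proj₂ IU.identity b) }) }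
      ; inverse = (λ { (a , b) → cong₂ _,_ (proj₁ IG.inverse a) (proj₁ IU.inverse b) })
                , (λ { (a , b) → cong₂ _,_ (proj₂ IG.inverse a) (proj₂ IU.inverse b) })
      ; ⁻¹-cong = λ { refl → refl } }

  _⊗_ : FinGroup
  _⊗_ = record
    { Carrier = C ; _≟_ = deq ; _∙_ = _·_ ; e = ε ; _⁻¹ = inv ; isGroup = isG
    ; elems = cartesianProduct G.elems U.elems
    ; complete = λ { (a , b) → ∈-cartesianProduct⁺ (G.complete a) (U.complete b) }
    ; unique = cartesianProduct⁺ G.unique U.unique }

count : {A : Set} → (A → Bool) → List A → ℕ
count P []       = 0
count P (x ∷ xs) = if P x then suc (count P xs) else count P xs

anyᵇ : {A : Set} → (A → Bool) → List A → Bool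
anyᵇ P []       = false
anyᵇ P (x ∷ xs) = P x ∨ anyᵇ P xs

sumℤ : {A : Set} → (A → ℤ) → List A → ℤ
sumℤ f []       = + 0
sumℤ f (x ∷ xs) = f x + sumℤ f xs

allFinL : (r : ℕ) → List (Fin r)
allFinL zero    = []
allFinL (suc r) = Fin.zero ∷ Data.List.map Fin.suc (allFinL r)
  where import Data.Fin as Fin
        import Data.List

module _ (H : FinGroup) where
  open FinGroup H

  Sub : Set
  Sub = Carrier → Bool

  _∈ˢ_ : Carrier → Sub → Set
  x ∈ˢ X = X x ≡ true

  _⊆ˢ_ : Sub → Sub → Set
  X ⊆ˢ Y = ∀ x → X x ≡ true → Y x ≡ true

  _≐_ : Sub → Sub → Set
  X ≐ Y = ∀ x → X x ≡ Y x

  ∣_∣ˢ : Sub → ℕ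
  ∣ X ∣ˢ = count X elems

  ∣H∣ : ℕ
  ∣H∣ = count (λ _ → true) elems

  singleton : Carrier → Sub
  singleton a x = ⌊ x ≟ a ⌋

  whole : Sub
  whole _ = true

  _∖ˢ_ : Sub → Sub → Sub
  (X ∖ˢ Y) x = X x ∧ not (Y x)

  _∩ˢ_ : Sub → Sub → Sub
  (X ∩ˢ Y) x = X x ∧ Y x

  inv : Sub → Sub
  inv X x = X (x ⁻¹)

  coset : Sub → Carrier → Sub
  coset K g x = K (x ∙ g ⁻¹)

  _·K_ : Sub → Sub → Sub
  (X ·K K) x = anyᵇ (λ k → K k ∧ X (x ∙ k ⁻¹)) elems

  IsSubgroup : Sub → Set
  IsSubgroup K = (e ∈ˢ K)
               × (∀ x y → x ∈ˢ K → y ∈ˢ K → (x ∙ y) ∈ˢ K)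
               × (∀ x → x ∈ˢ K → (x ⁻¹) ∈ˢ K)

  -- group ring ℤH: elements are functions H → ℤ (finite support is automatic)
  ℤ[H] : Set
  ℤ[H] = Carrier → ℤ

  ul : Sub → ℤ[H]
  ul X x = if X x then + 1 else + 0

  _⊕_ : ℤ[H] → ℤ[H] → ℤ[H]
  (f ⊕ g) x = f x + g x

  _·ℤ_ : ℤ → ℤ[H] → ℤ[H]
  (c ·ℤ f) x = c * f x

  _⊛_ : ℤ[H] → ℤ[H] → ℤ[H]
  (f ⊛ g) x = sumℤ (λ y → f y * g (y ⁻¹ ∙ x)) elems

  _≈ᴿ_ : ℤ[H] → ℤ[H] → Set
  f ≈ᴿ g = ∀ x → f x ≡ g x

  lin : {r : ℕ} → (Fin r → ℤ) → (Fin r → Sub) → ℤ[H]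
  lin {r} c T x = sumℤ (λ i → c i * ul (T i) x) (allFinL r)

  -- S-rings, given by their family of basic sets T : Fin r → Sub
  -- (r = rank = number of basic sets)

  InSpan : {r : ℕ} → (Fin r → Sub) → ℤ[H] → Set
  InSpan T f = Σ (_ → ℤ) λ c → f ≈ᴿ lin c T

  IsPartition : {r : ℕ} → (Fin r → Sub) → Set
  IsPartition {r} T = (∀ i → Σ Carrier λ x → x ∈ˢ T i)
                    × (∀ x → Σ (Fin r) λ i → x ∈ˢ T i)
                    × (∀ x i j → x ∈ˢ T i → x ∈ˢ T j → i ≡ j)

  IsSRing : {r : ℕ} → (Fin r → Sub) → Set
  IsSRing {r} T = IsPartition T
                × (Σ (Fin r) λ i → T i ≐ singleton e)
                × (∀ i → Σ (Fin r) λ j → T j ≐ inv (T i))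
                × (∀ i j → InSpan T (ul (T i) ⊛ ul (T j)))

  IsSymmetric : {r : ℕ} → (Fin r → Sub) → Set
  IsSymmetric T = ∀ i → T i ≐ inv (T i)

  subsetᵇ : Sub → Sub → Bool
  subsetᵇ X Y = not (anyᵇ (λ x → X x ∧ not (Y x)) elems)

  eqSubᵇ : Sub → Sub → Bool
  eqSubᵇ X Y = subsetᵇ X Y ∧ subsetᵇ Y X

  rankRestr : {r : ℕ} → (Fin r → Sub) → Sub → ℕ
  rankRestr {r} T K = count (λ i → subsetᵇ (T i) K) (allFinL r)

  distinct : List Sub → ℕ
  distinct []       = 0
  distinct (X ∷ Xs) = if anyᵇ (eqSubᵇ X) Xs then distinct Xs else suc (distinct Xs)

  -- rank of the quotient 𝒜_{H/K}: number of distinct images T_i K / K,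
  -- an image being represented by its full preimage T_i K ⊆ H
  rankQuot : {r : ℕ} → (Fin r → Sub) → Sub → ℕ
  rankQuot {r} T K = distinct (Data.List.map (λ i → T i ·K K) (allFinL r))
    where import Data.List

  ProperNontrivial : Sub → Set
  ProperNontrivial K = IsSubgroup K
                     × (Σ Carrier λ x → x ∈ˢ K × x ≢ e)
                     × (Σ Carrier λ x → K x ≡ false)

  -- Higmanian S-ring (rank 5) with parameters (a , b , c , k , t) =
  -- (|H:K| , |K:L| , |L| , k , t); indices are expressed multiplicatively.
  IsHigmanian : (T : Fin 5 → Sub) → ℕ → ℕ → ℕ → ℕ → ℤ → Set
  IsHigmanian T a b c k t =
    IsSRing T × IsSymmetric T ×
    Σ Sub λ L → Σ Sub λ K →
      ProperNontrivial L × ProperNontrivial K ×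
      L ⊆ˢ K × (Σ Carrier λ x → x ∈ˢ K × L x ≡ false) ×
      InSpan T (ul L) × InSpan T (ul K) ×
      rankRestr T L ≡ 2 × rankQuot T K ≡ 2 ×
      rankQuot T L ≡ 3 × rankRestr T K ≡ 3 ×
      Σ (Fin 5) λ x → Σ (Fin 5) λ y →
        x ≢ y × subsetᵇ (T x) K ≡ false × subsetᵇ (T y) K ≡ false ×
        Data.Nat._≤_ ∣ T y ∣ˢ ∣ T x ∣ˢ ×
        Data.Nat._*_ a ∣ K ∣ˢ ≡ ∣H∣ ×
        Data.Nat._*_ b ∣ L ∣ˢ ≡ ∣ K ∣ˢ ×
        ∣ L ∣ˢ ≡ c ×
        (∀ g → K g ≡ false → ∣ T x ∩ˢ coset K g ∣ˢ ≡ k) ×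
        (Σ (Fin 5 → ℤ) λ p → (ul (T y) ⊛ ul (T x)) ≈ᴿ lin p T × p y ≡ t)
    where import Data.Nat

module _ (G : FinGroup) where
  open FinGroup G

  IsRDS : (N X : Sub G) → ℕ → ℕ → ℕ → ℕ → Set
  IsRDS N X m n k λ' =
    IsSubgroup G N × ∣H∣ G ≡ Data.Nat._*_ m n × ∣_∣ˢ G N ≡ n × ∣_∣ˢ G X ≡ k ×
    _≈ᴿ_ G (_⊛_ G (ul G X) (ul G (inv G X)))
           (_⊕_ G (_·ℤ_ G (+ k) (ul G (singleton G e)))
                  (_·ℤ_ G (+ λ') (ul G (_∖ˢ_ G (whole G) N))))
    where import Data.Nat
          open import Data.Nat using (ℕ)

  IsClosedLinkedSystem :
    (W : Set) → DecidableEquality W → List W →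
    (N : Sub G) → (X : W → Sub G) →
    (χ : W → W) → (ψ : (α β : W) → .(β ≢ χ α) → W) →
    (m n k λ' w μ ν : ℕ) → Set
  IsClosedLinkedSystem W _≟W_ Welems N X χ ψ m n k λ' w μ ν =
    ((∀ α → α ∈ Welems) × Unique Welems × Data.List.length Welems ≡ w) ×
    Data.Nat._≤_ 2 w ×
    (∀ α → IsRDS N (X α) m n k λ') ×
    Bijective _≡_ _≡_ χ ×
    (∀ α → _≐_ G (inv G (X α)) (X (χ α))) ×
    (∀ α → _≈ᴿ_ G (_⊛_ G (ul G (X α)) (ul G (X (χ α))))
                  (_⊕_ G (_·ℤ_ G (+ k) (ul G (singleton G e)))
                         (_·ℤ_ G (+ λ') (ul G (_∖ˢ_ G (whole G) N))))) ×
    (∀ α β → (h : β ≢ χ α) →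
       _≈ᴿ_ G (_⊛_ G (ul G (X α)) (ul G (X β)))
              (_⊕_ G (_·ℤ_ G (+ μ) (ul G (X (ψ α β h))))
                     (_·ℤ_ G (+ ν) (ul G (_∖ˢ_ G (whole G) (X (ψ α β h)))))))
    where import Data.Nat
          import Data.List

-- multiplication ψ̂ of the associated group W^∞ = Maybe W (∞ = nothing)
ψ̂ : {W : Set} → DecidableEquality W → (χ : W → W) →
     ((α β : W) → .(β ≢ χ α) → W) → Maybe W → Maybe W → Maybe W
ψ̂ _≟_ χ ψ nothing  b        = b
ψ̂ _≟_ χ ψ (just α) nothing  = just α
ψ̂ _≟_ χ ψ (just α) (just β) with β ≟ χ α
... | yes _ = nothing
... | no h  = just (ψ α β h)

module _ (G U : FinGroup) {W : Set} (φ : FinGroup.Carrier U → Maybe W)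
         (N : Sub G) (X : W → Sub G) where
  private
    module G = FinGroup G
    module U = FinGroup U

  Tset : Fin 5 → Sub (G ⊗ U)
  Tset Fin.zero (g , u) = ⌊ g G.≟ G.e ⌋ ∧ ⌊ u U.≟ U.e ⌋
  Tset (Fin.suc Fin.zero) (g , u) = N g ∧ not ⌊ g G.≟ G.e ⌋ ∧ ⌊ u U.≟ U.e ⌋
  Tset (Fin.suc (Fin.suc Fin.zero)) (g , u) = not (N g) ∧ ⌊ u U.≟ U.e ⌋
  Tset (Fin.suc (Fin.suc (Fin.suc Fin.zero))) (g , u) with φ u
  ... | nothing = false
  ... | just α  = not ⌊ u U.≟ U.e ⌋ ∧ X α g
  Tset (Fin.suc (Fin.suc (Fin.suc (Fin.suc Fin.zero)))) (g , u) with φ u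
  ... | nothing = false
  ... | just α  = not ⌊ u U.≟ U.e ⌋ ∧ not (X α g)

{-# OPTIONS --safe #-}
-- Write elements of ℤ[G × U] as layered sums Σ_u c(u) · u s_u with c the indicator of e or of
-- U ∖ {e}.  The basic sets are unitriangular combinations of E = {e}, N₀ = N, G₀ = G, X* = T₃
-- and G* = (G × U) ∖ G, so closure under multiplication reduces, layer by layer, to products in
-- ℤG: N X_α = X_α N = G (a semiregular RDS with X_α⁽⁻¹⁾ also an RDS is a transversal of the
-- cosets of N), X_α X_χ(α) = nλ e + λ (G ∖ N) and X_α X_β = μ X_ψ(α,β) + ν (G ∖ X_ψ(α,β)), the
-- isomorphism φ turning the convolution over U into ψ.  Augmenting the last identity gives
-- nλ = μ + ν (n - 1), whence t = (w - 1)(nλ - μ) = (n - 1)(w - 1) ν; the subgroups are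
-- L = N × {e} < K = G × {e}, and the ranks and k are read off from the layers.
module Submission where

module HigmanianSRing where

  open import Defs
  open import Algebra.Bundles using (Group; AbelianGroup)
  import Algebra.Properties.Group as GroupProperties
  import Algebra.Properties.CommutativeSemigroup as CommSemigroupProperties
  open import Data.Bool using (Bool; true; false; not; _∧_; if_then_else_)
  import Data.Bool.Properties as Boolₚ
  open import Data.Empty using (⊥-elim)
  open import Data.Fin using (Fin) renaming (zero to 0F)
  import Data.Fin as Fin
  import Data.Fin.Properties as Finₚ
  open import Data.Fin.Patterns using (1F; 2F; 3F; 4F)
  open import Data.Integer as ℤ using (ℤ; +_; _+_; _*_; -_; _-_; _≤_)
  import Data.Integer.Properties as ℤₚ
  open import Data.List using (List; []; _∷_; _++_; map; cartesianProduct; length)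
  open import Data.List.Membership.Propositional using (_∈_; _∉_)
  open import Data.List.Membership.Propositional.Properties using (∈-map⁺; ∈-map⁻)
  import Data.List.Properties as Listₚ
  import Data.List.Relation.Unary.Unique.Propositional.Properties as Uniqueₚ
  open import Data.Maybe using (Maybe; just; nothing)
  import Data.Maybe.Properties as Maybeₚ
  open import Data.List.Relation.Unary.All as All using (All)
  open import Data.List.Relation.Unary.AllPairs using ([]; _∷_)
  open import Data.List.Relation.Unary.Any using (here; there)
  open import Data.List.Relation.Unary.Unique.Propositional using (Unique)
  open import Data.Nat as ℕ using (ℕ; zero; suc)
  import Data.Nat.Properties as ℕₚ
  open import Data.Product using (Σ; _×_; _,_; proj₁; proj₂)
  open import Data.Sum using (_⊎_; inj₁; inj₂)
  open import Function.Base using (_∘_; const)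
  open import Function.Definitions using (Injective; StrictlySurjective; Bijective)
  open import Level using (0ℓ)
  open import Relation.Binary.Definitions using (DecidableEquality)
  open import Relation.Binary.PropositionalEquality
  open import Relation.Nullary using (yes; no; ¬_)
  open import Relation.Nullary.Decidable using (⌊_⌋)
  open import Data.Integer.Tactic.RingSolver using (solve-∀)

  module ℤ+ = GroupProperties (AbelianGroup.group ℤₚ.+-0-abelianGroup)

  +[m∸1]≡+m-1 : ∀ {m} → 1 ℕ.≤ m → + (m ℕ.∸ 1) ≡ + m - + 1
  +[m∸1]≡+m-1 {m} 1≤m = sym (trans (ℤₚ.m-n≡m⊖n m 1) (ℤₚ.⊖-≥ 1≤m))

  *-distribˡ-- : ∀ a b c → a * (b - c) ≡ a * b - a * c
  *-distribˡ-- a b c = trans (ℤₚ.*-distribˡ-+ a b (- c)) (cong (_+_ (a * b)) (sym (ℤₚ.neg-distribʳ-* a c)))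

  ⟦_⟧ : Bool → ℤ
  ⟦ b ⟧ = if b then + 1 else + 0

  ⟦⟧-∧ : ∀ b c → ⟦ b ⟧ * ⟦ c ⟧ ≡ ⟦ b ∧ c ⟧
  ⟦⟧-∧ true  true  = refl
  ⟦⟧-∧ true  false = refl
  ⟦⟧-∧ false c     = refl

  ⟦⟧-not : ∀ b → ⟦ not b ⟧ ≡ + 1 - ⟦ b ⟧
  ⟦⟧-not true  = refl
  ⟦⟧-not false = refl

  ⟦⟧-nonneg : ∀ b → + 0 ≤ ⟦ b ⟧
  ⟦⟧-nonneg true  = ℤ.+≤+ ℕ.z≤n
  ⟦⟧-nonneg false = ℤ.+≤+ ℕ.z≤n

  ⟦⟧-injective : ∀ {b c} → ⟦ b ⟧ ≡ ⟦ c ⟧ → b ≡ c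
  ⟦⟧-injective {true}  {true}  _ = refl
  ⟦⟧-injective {false} {false} _ = refl

  T⇔T⇒≡ : ∀ {b c} → (b ≡ true → c ≡ true) → (c ≡ true → b ≡ true) → b ≡ c
  T⇔T⇒≡ {true}  {true}  _ _ = refl
  T⇔T⇒≡ {true}  {false} f _ = sym (f refl)
  T⇔T⇒≡ {false} {true}  _ g = g refl
  T⇔T⇒≡ {false} {false} _ _ = refl

  ∧-true⁻ : ∀ {b c} → b ∧ c ≡ true → b ≡ true × c ≡ true
  ∧-true⁻ {true} {true} _ = refl , refl

  module _ {A : Set} (_≟_ : DecidableEquality A) where

    ⌊≟⌋-refl : ∀ a → ⌊ a ≟ a ⌋ ≡ true
    ⌊≟⌋-refl a with a ≟ a
    ... | yes _  = refl
    ... | no a≢a = ⊥-elim (a≢a refl)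

    ⌊≟⌋-≢ : ∀ {a b} → a ≢ b → ⌊ a ≟ b ⌋ ≡ false
    ⌊≟⌋-≢ {a} {b} a≢b with a ≟ b
    ... | yes a≡b = ⊥-elim (a≢b a≡b)
    ... | no _    = refl

    ⌊≟⌋-true⁻ : ∀ {a b} → ⌊ a ≟ b ⌋ ≡ true → a ≡ b
    ⌊≟⌋-true⁻ {a} {b} h with a ≟ b
    ... | yes a≡b = a≡b

    ⌊≟⌋-false⁻ : ∀ {a b} → not ⌊ a ≟ b ⌋ ≡ true → a ≢ b
    ⌊≟⌋-false⁻ {a} {b} h with a ≟ b
    ... | no a≢b = a≢b

  module _ {A : Set} where

    sumℤ-cong : ∀ (xs : List A) {f g : A → ℤ} → (∀ x → f x ≡ g x) → sumℤ f xs ≡ sumℤ g xs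
    sumℤ-cong []       f≗g = refl
    sumℤ-cong (x ∷ xs) f≗g = cong₂ _+_ (f≗g x) (sumℤ-cong xs f≗g)

    sumℤ-zero : ∀ (xs : List A) → sumℤ (λ _ → + 0) xs ≡ + 0
    sumℤ-zero []       = refl
    sumℤ-zero (x ∷ xs) = trans (ℤₚ.+-identityˡ _) (sumℤ-zero xs)

    sumℤ-+ : ∀ (xs : List A) (f g : A → ℤ) → sumℤ (λ x → f x + g x) xs ≡ sumℤ f xs + sumℤ g xs
    sumℤ-+ []       f g = refl
    sumℤ-+ (x ∷ xs) f g = begin
      f x + g x + sumℤ (λ x → f x + g x) xs  ≡⟨ cong (_+_ (f x + g x)) (sumℤ-+ xs f g) ⟩
      f x + g x + (sumℤ f xs + sumℤ g xs)   ≡⟨ interchange (f x) (g x) (sumℤ f xs) (sumℤ g xs) ⟩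
      f x + sumℤ f xs + (g x + sumℤ g xs)   ∎
      where open ≡-Reasoning
            open CommSemigroupProperties ℤₚ.+-commutativeSemigroup using (interchange)

    sumℤ-*ˡ : ∀ (xs : List A) (c : ℤ) (f : A → ℤ) → sumℤ (λ x → c * f x) xs ≡ c * sumℤ f xs
    sumℤ-*ˡ []       c f = sym (ℤₚ.*-zeroʳ c)
    sumℤ-*ˡ (x ∷ xs) c f = trans (cong (_+_ (c * f x)) (sumℤ-*ˡ xs c f)) (sym (ℤₚ.*-distribˡ-+ c (f x) _))

    sumℤ-*ʳ : ∀ (xs : List A) (c : ℤ) (f : A → ℤ) → sumℤ (λ x → f x * c) xs ≡ sumℤ f xs * c
    sumℤ-*ʳ xs c f = trans (sumℤ-cong xs (λ x → ℤₚ.*-comm (f x) c))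
                           (trans (sumℤ-*ˡ xs c f) (ℤₚ.*-comm c (sumℤ f xs)))

    sumℤ-neg : ∀ (xs : List A) (f : A → ℤ) → sumℤ (λ x → - f x) xs ≡ - sumℤ f xs
    sumℤ-neg []       f = refl
    sumℤ-neg (x ∷ xs) f = trans (cong (_+_ (- f x)) (sumℤ-neg xs f)) (sym (ℤₚ.neg-distrib-+ (f x) _))

    sumℤ-- : ∀ (xs : List A) (f g : A → ℤ) → sumℤ (λ x → f x - g x) xs ≡ sumℤ f xs - sumℤ g xs
    sumℤ-- xs f g = trans (sumℤ-+ xs f (λ x → - g x)) (cong (_+_ (sumℤ f xs)) (sumℤ-neg xs g))

    sumℤ-++ : ∀ (xs ys : List A) (f : A → ℤ) → sumℤ f (xs ++ ys) ≡ sumℤ f xs + sumℤ f ys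
    sumℤ-++ []       ys f = sym (ℤₚ.+-identityˡ _)
    sumℤ-++ (x ∷ xs) ys f = trans (cong (_+_ (f x)) (sumℤ-++ xs ys f)) (sym (ℤₚ.+-assoc (f x) _ _))

    sumℤ-one : ∀ (xs : List A) → sumℤ (λ _ → + 1) xs ≡ + length xs
    sumℤ-one []       = refl
    sumℤ-one (x ∷ xs) = trans (cong (_+_ (+ 1)) (sumℤ-one xs)) (sym (ℤₚ.pos-+ 1 (length xs)))

    sumℤ-nonneg : ∀ (xs : List A) (f : A → ℤ) → (∀ x → + 0 ≤ f x) → + 0 ≤ sumℤ f xs
    sumℤ-nonneg []       f f≥0 = ℤₚ.≤-refl
    sumℤ-nonneg (x ∷ xs) f f≥0 = ℤₚ.+-mono-≤ (f≥0 x) (sumℤ-nonneg xs f f≥0)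

    ≤-sumℤ : ∀ (xs : List A) (f : A → ℤ) → (∀ x → + 0 ≤ f x) → ∀ {x} → x ∈ xs → f x ≤ sumℤ f xs
    ≤-sumℤ (y ∷ xs) f f≥0 (here refl) =
      ℤₚ.≤-trans (ℤₚ.≤-reflexive (sym (ℤₚ.+-identityʳ (f y)))) (ℤₚ.+-monoʳ-≤ (f y) (sumℤ-nonneg xs f f≥0))
    ≤-sumℤ (y ∷ xs) f f≥0 (there x∈xs) =
      ℤₚ.≤-trans (≤-sumℤ xs f f≥0 x∈xs)
        (ℤₚ.≤-trans (ℤₚ.≤-reflexive (sym (ℤₚ.+-identityˡ _))) (ℤₚ.+-monoˡ-≤ (sumℤ f xs) (f≥0 y)))

    count≡sumℤ : ∀ (P : A → Bool) (xs : List A) → + count P xs ≡ sumℤ (λ x → ⟦ P x ⟧) xs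
    count≡sumℤ P []       = refl
    count≡sumℤ P (x ∷ xs) with P x
    ... | true  = trans (ℤₚ.pos-+ 1 (count P xs)) (cong (_+_ (+ 1)) (count≡sumℤ P xs))
    ... | false = trans (count≡sumℤ P xs) (sym (ℤₚ.+-identityˡ _))

    sumℤ-map : ∀ {B : Set} (xs : List A) (h : A → B) (f : B → ℤ) → sumℤ f (map h xs) ≡ sumℤ (f ∘ h) xs
    sumℤ-map []       h f = refl
    sumℤ-map (x ∷ xs) h f = cong (_+_ (f (h x))) (sumℤ-map xs h f)

  module _ {A B : Set} where

    sumℤ-comm : ∀ (xs : List A) (ys : List B) (f : A → B → ℤ) →
      sumℤ (λ x → sumℤ (f x) ys) xs ≡ sumℤ (λ y → sumℤ (λ x → f x y) xs) ys
    sumℤ-comm []       ys f = sym (sumℤ-zero ys)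
    sumℤ-comm (x ∷ xs) ys f = trans (cong (_+_ (sumℤ (f x) ys)) (sumℤ-comm xs ys f))
                                    (sym (sumℤ-+ ys (f x) (λ y → sumℤ (λ x → f x y) xs)))

    sumℤ-cartesianProduct : ∀ (xs : List A) (ys : List B) (f : A × B → ℤ) →
      sumℤ f (cartesianProduct xs ys) ≡ sumℤ (λ x → sumℤ (λ y → f (x , y)) ys) xs
    sumℤ-cartesianProduct []       ys f = refl
    sumℤ-cartesianProduct (x ∷ xs) ys f =
      trans (sumℤ-++ (map (x ,_) ys) _ f)
            (cong₂ _+_ (sumℤ-map ys (x ,_) f) (sumℤ-cartesianProduct xs ys f))

    sumℤ-*-sumℤ : ∀ (xs : List A) (ys : List B) (f : A → ℤ) (g : B → ℤ) →
      sumℤ f xs * sumℤ g ys ≡ sumℤ (λ x → sumℤ (λ y → f x * g y) ys) xs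
    sumℤ-*-sumℤ xs ys f g = trans (sym (sumℤ-*ʳ xs (sumℤ g ys) f))
                                  (sumℤ-cong xs (λ x → sym (sumℤ-*ˡ ys (f x) g)))

  module _ {A : Set} where

    anyᵇ-true⁺ : ∀ (P : A → Bool) (xs : List A) {x} → x ∈ xs → P x ≡ true → anyᵇ P xs ≡ true
    anyᵇ-true⁺ P (y ∷ xs) (here refl) Px rewrite Px = refl
    anyᵇ-true⁺ P (y ∷ xs) (there x∈xs) Px with P y
    ... | true  = refl
    ... | false = anyᵇ-true⁺ P xs x∈xs Px

    anyᵇ-false⁺ : ∀ (P : A → Bool) (xs : List A) → (∀ x → P x ≡ false) → anyᵇ P xs ≡ false
    anyᵇ-false⁺ P []       ¬P = refl
    anyᵇ-false⁺ P (y ∷ xs) ¬P rewrite ¬P y = anyᵇ-false⁺ P xs ¬P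

    anyᵇ-true⁻ : ∀ (P : A → Bool) (xs : List A) → anyᵇ P xs ≡ true → Σ A λ x → P x ≡ true
    anyᵇ-true⁻ P (y ∷ xs) h with P y in Py
    ... | true  = y , Py
    ... | false = anyᵇ-true⁻ P xs h

    sumℤ⟦⟧-false : ∀ (P : A → Bool) (xs : List A) → (∀ x → x ∈ xs → P x ≡ false) →
                   sumℤ (λ x → ⟦ P x ⟧) xs ≡ + 0
    sumℤ⟦⟧-false P []       ¬P = refl
    sumℤ⟦⟧-false P (x ∷ xs) ¬P rewrite ¬P x (here refl) =
      trans (ℤₚ.+-identityˡ _) (sumℤ⟦⟧-false P xs (λ y y∈xs → ¬P y (there y∈xs)))

    sumℤ⟦⟧-≢0 : ∀ (P : A → Bool) (xs : List A) → sumℤ (λ x → ⟦ P x ⟧) xs ≢ + 0 → Σ A λ x → P x ≡ true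
    sumℤ⟦⟧-≢0 P []       ≢0 = ⊥-elim (≢0 refl)
    sumℤ⟦⟧-≢0 P (x ∷ xs) ≢0 with P x in Px
    ... | true  = x , Px
    ... | false = sumℤ⟦⟧-≢0 P xs (≢0 ∘ trans (ℤₚ.+-identityˡ _))

    sumℤ⟦⟧≤1 : ∀ (P : A → Bool) {xs : List A} → Unique xs →
               (∀ a b → P a ≡ true → P b ≡ true → a ≡ b) → sumℤ (λ x → ⟦ P x ⟧) xs ≤ + 1
    sumℤ⟦⟧≤1 P {[]}     _            P-prop = ℤ.+≤+ ℕ.z≤n
    sumℤ⟦⟧≤1 P {x ∷ xs} (x∉xs ∷ !xs) P-prop with P x in Px
    ... | true  = ℤₚ.≤-reflexive (cong (_+_ (+ 1)) (sumℤ⟦⟧-false P xs ¬P))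
      where
      ¬P : ∀ y → y ∈ xs → P y ≡ false
      ¬P y y∈xs with P y in Py
      ... | true  = ⊥-elim (All.lookup x∉xs y∈xs (P-prop x y Px Py))
      ... | false = refl
    ... | false = ℤₚ.≤-trans (ℤₚ.≤-reflexive (ℤₚ.+-identityˡ _)) (sumℤ⟦⟧≤1 P !xs P-prop)

    sumℤ⟦⟧≡1⇒∃! : ∀ (P : A → Bool) (xs : List A) → sumℤ (λ x → ⟦ P x ⟧) xs ≡ + 1 →
                  Σ A λ x → P x ≡ true × (∀ y → y ∈ xs → P y ≡ true → y ≡ x)
    sumℤ⟦⟧≡1⇒∃! P (x ∷ xs) ≡1 with P x in Px
    ... | true  = x , Px , unique
      where
      rest≡0 : sumℤ (λ x → ⟦ P x ⟧) xs ≡ + 0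
      rest≡0 = ℤ+.∙-cancelˡ (+ 1) _ _ (trans ≡1 (sym (ℤₚ.+-identityʳ (+ 1))))
      unique : ∀ y → y ∈ x ∷ xs → P y ≡ true → y ≡ x
      unique y (here y≡x)   _  = y≡x
      unique y (there y∈xs) Py =
        ⊥-elim (1≰0 (subst₂ _≤_ (cong ⟦_⟧ Py) rest≡0 (≤-sumℤ xs (λ x → ⟦ P x ⟧) (⟦⟧-nonneg ∘ P) y∈xs)))
        where 1≰0 : ¬ (+ 1 ≤ + 0)
              1≰0 (ℤ.+≤+ ())
    ... | false with sumℤ⟦⟧≡1⇒∃! P xs (trans (sym (ℤₚ.+-identityˡ _)) ≡1)
    ...   | y , Py , unique = y , Py , λ { z (here refl) Pz → ⊥-elim (false≢true (trans (sym Px) Pz))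
                                         ; z (there z∈xs) Pz → unique z z∈xs Pz }
      where false≢true : false ≢ true
            false≢true ()

    sumℤ≡length⇒≡1 : ∀ (f : A → ℤ) (xs : List A) → (∀ x → f x ≤ + 1) → sumℤ f xs ≡ + length xs →
                     ∀ {x} → x ∈ xs → f x ≡ + 1
    sumℤ≡length⇒≡1 f xs f≤1 Σf≡ {x} x∈xs = ℤₚ.≤-antisym (f≤1 x) (ℤₚ.i-j≤0⇒i≤j 1-fx≤0)
      where
      Σ1-f≡0 : sumℤ (λ x → + 1 - f x) xs ≡ + 0
      Σ1-f≡0 = trans (sumℤ-- xs (λ _ → + 1) f)
                     (trans (cong₂ _-_ (sumℤ-one xs) Σf≡) (ℤₚ.+-inverseʳ (+ length xs)))
      1-fx≤0 : + 1 - f x ≤ + 0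
      1-fx≤0 = ℤₚ.≤-trans (≤-sumℤ xs (λ x → + 1 - f x) (λ x → ℤₚ.i≤j⇒0≤j-i (f≤1 x)) x∈xs)
                          (ℤₚ.≤-reflexive Σ1-f≡0)

  ∈-allFinL : ∀ {r} (i : Fin r) → i ∈ allFinL r
  ∈-allFinL 0F          = here refl
  ∈-allFinL (Fin.suc i) = there (∈-map⁺ Fin.suc (∈-allFinL i))

  allFinL-unique : ∀ r → Unique (allFinL r)
  allFinL-unique zero    = []
  allFinL-unique (suc r) = All.tabulate 0F∉ ∷ Uniqueₚ.map⁺ Finₚ.suc-injective (allFinL-unique r)
    where
    0F∉ : ∀ {i} → i ∈ map Fin.suc (allFinL r) → 0F ≢ i
    0F∉ i∈ refl with ∈-map⁻ Fin.suc i∈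
    ... | _ , _ , ()

  module Kronecker {A : Set} (_≟_ : DecidableEquality A) where

    δ : A → A → ℤ
    δ a x = ⟦ ⌊ x ≟ a ⌋ ⟧

    δ-refl : ∀ a → δ a a ≡ + 1
    δ-refl a = cong ⟦_⟧ (⌊≟⌋-refl _≟_ a)

    δ-≢ : ∀ {a x} → x ≢ a → δ a x ≡ + 0
    δ-≢ x≢a = cong ⟦_⟧ (⌊≟⌋-≢ _≟_ x≢a)

    δ-cases : ∀ a x → (x ≡ a × δ a x ≡ + 1) ⊎ (x ≢ a × δ a x ≡ + 0)
    δ-cases a x with x ≟ a
    ... | yes x≡a = inj₁ (x≡a , refl)
    ... | no x≢a  = inj₂ (x≢a , refl)

    sumℤ-δ-∉ : ∀ (xs : List A) {a} → a ∉ xs → (F : A → ℤ) → sumℤ (λ x → δ a x * F x) xs ≡ + 0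
    sumℤ-δ-∉ []       a∉ F = refl
    sumℤ-δ-∉ (x ∷ xs) {a} a∉ F with x ≟ a
    ... | yes refl = ⊥-elim (a∉ (here refl))
    ... | no _     = trans (ℤₚ.+-identityˡ _) (sumℤ-δ-∉ xs (a∉ ∘ there) F)

    sumℤ-δ : ∀ {xs : List A} → Unique xs → ∀ {a} → a ∈ xs → (F : A → ℤ) →
             sumℤ (λ x → δ a x * F x) xs ≡ F a
    sumℤ-δ {x ∷ xs} (x∉xs ∷ !xs) {a} a∈ F with x ≟ a
    ... | yes refl = trans (cong (_+_ (+ 1 * F x)) (sumℤ-δ-∉ xs (λ x∈xs → All.lookup x∉xs x∈xs refl) F))
                           (trans (ℤₚ.+-identityʳ _) (ℤₚ.*-identityˡ _))
    ... | no x≢a with a∈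
    ...   | here a≡x   = ⊥-elim (x≢a (sym a≡x))
    ...   | there a∈xs = trans (ℤₚ.+-identityˡ _) (sumℤ-δ !xs a∈xs F)

  module _ {A B : Set} (_≟A_ : DecidableEquality A) (_≟B_ : DecidableEquality B) where
    private
      module A = Kronecker _≟A_
      module B = Kronecker _≟B_

    sumℤ-bijection : ∀ {xs : List A} {ys : List B} → Unique xs → (∀ a → a ∈ xs) → Unique ys → (∀ b → b ∈ ys) →
                     (h : A → B) → Injective _≡_ _≡_ h → StrictlySurjective _≡_ h →
                     (f : B → ℤ) → sumℤ (f ∘ h) xs ≡ sumℤ f ys
    sumℤ-bijection {xs} {ys} !xs xs-complete !ys ys-complete h h-inj h-surj f = begin
      sumℤ (f ∘ h) xs                                      ≡⟨ sumℤ-cong xs (λ a → sym (B.sumℤ-δ !ys (ys-complete (h a)) f)) ⟩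
      sumℤ (λ a → sumℤ (λ b → B.δ (h a) b * f b) ys) xs    ≡⟨ sumℤ-comm xs ys _ ⟩
      sumℤ (λ b → sumℤ (λ a → B.δ (h a) b * f b) xs) ys    ≡⟨ sumℤ-cong ys (λ b → sumℤ-*ʳ xs (f b) (λ a → B.δ (h a) b)) ⟩
      sumℤ (λ b → sumℤ (λ a → B.δ (h a) b) xs * f b) ys    ≡⟨ sumℤ-cong ys (λ b → cong (_* f b) (one-preimage b)) ⟩
      sumℤ (λ b → + 1 * f b) ys                            ≡⟨ sumℤ-cong ys (λ b → ℤₚ.*-identityˡ (f b)) ⟩
      sumℤ f ys                                            ∎
      where
      open ≡-Reasoning
      one-preimage : ∀ b → sumℤ (λ a → B.δ (h a) b) xs ≡ + 1
      one-preimage b with h-surj b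
      ... | a₀ , refl = trans (sumℤ-cong xs (λ a → trans (δ-h a) (sym (ℤₚ.*-identityʳ _))))
                              (A.sumℤ-δ !xs (xs-complete a₀) (λ _ → + 1))
        where
        δ-h : ∀ a → B.δ (h a) (h a₀) ≡ A.δ a₀ a
        δ-h a with h a₀ ≟B h a | a ≟A a₀
        ... | yes _     | yes _    = refl
        ... | no _      | no _     = refl
        ... | yes ha₀≡ha | no a≢a₀ = ⊥-elim (a≢a₀ (h-inj (sym ha₀≡ha)))
        ... | no ha₀≢ha | yes refl = ⊥-elim (ha₀≢ha refl)

  module FinGroupProperties (H : FinGroup) where
    open FinGroup H public

    group : Group 0ℓ 0ℓ
    group = record { isGroup = isGroup }

    open Group group public using (_\\_; _//_; assoc; identityˡ; identityʳ; inverseˡ; inverseʳ)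
    open GroupProperties group public
      using (ε⁻¹≈ε; ⁻¹-involutive; ⁻¹-injective; ⁻¹-anti-homo-∙; ⁻¹-anti-homo-\\; ⁻¹-anti-homo-//;
             \\-leftDividesˡ; \\-leftDividesʳ; //-rightDividesˡ; //-rightDividesʳ; x∙y⁻¹≈ε⇒x≈y)
    open Kronecker _≟_ public

    ε\\x≡x : ∀ x → e \\ x ≡ x
    ε\\x≡x x = trans (cong (_∙ x) ε⁻¹≈ε) (identityˡ x)

    x//ε≡x : ∀ x → x // e ≡ x
    x//ε≡x x = trans (cong (x ∙_) ε⁻¹≈ε) (identityʳ x)

    x\\y≡ε⇒x≡y : ∀ x y → x \\ y ≡ e → x ≡ y
    x\\y≡ε⇒x≡y x y x\\y≡ε = sym (trans (sym (\\-leftDividesˡ x y)) (trans (cong (x ∙_) x\\y≡ε) (identityʳ x)))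

    ⌊⁻¹≟ε⌋ : ∀ x → ⌊ (x ⁻¹) ≟ e ⌋ ≡ ⌊ x ≟ e ⌋
    ⌊⁻¹≟ε⌋ x = T⇔T⇒≡ (λ h → ≡ε⇒ (trans (sym (⁻¹-involutive x))
                                          (trans (cong _⁻¹ (⌊≟⌋-true⁻ _≟_ h)) ε⁻¹≈ε)))
                     (λ h → ≡ε⇒ (trans (cong _⁻¹ (⌊≟⌋-true⁻ _≟_ h)) ε⁻¹≈ε))
      where
      ≡ε⇒ : ∀ {y} → y ≡ e → ⌊ y ≟ e ⌋ ≡ true
      ≡ε⇒ refl = ⌊≟⌋-refl _≟_ e

    x//[y\\x]≡y : ∀ x y → x // (y \\ x) ≡ y
    x//[y\\x]≡y x y = trans (cong (x ∙_) (⁻¹-anti-homo-\\ y x)) (\\-leftDividesˡ x y)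

    \\ʳ-injective : ∀ z → Injective _≡_ _≡_ (_\\ z)
    \\ʳ-injective z {x} {y} x\\z≡y\\z =
      ⁻¹-injective (trans (sym (//-rightDividesʳ z (x ⁻¹))) (trans (cong (_// z) x\\z≡y\\z) (//-rightDividesʳ z (y ⁻¹))))

    [x\\z]//[y\\z]≡x\\y : ∀ x y z → (x \\ z) // (y \\ z) ≡ x \\ y
    [x\\z]//[y\\z]≡x\\y x y z = trans (cong ((x \\ z) ∙_) (⁻¹-anti-homo-\\ y z))
                                    (trans (assoc _ _ _) (cong (x ⁻¹ ∙_) (\\-leftDividesˡ z y)))

    [x//y]\\x≡y : ∀ x y → (x // y) \\ x ≡ y
    [x//y]\\x≡y x y = trans (cong (_∙ x) (⁻¹-anti-homo-// x y)) (//-rightDividesˡ x y)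

    ⌊∙≟ε⌋ : ∀ {x y} → ⌊ x ≟ e ⌋ ≡ true → ⌊ y ≟ e ⌋ ≡ true → ⌊ (x ∙ y) ≟ e ⌋ ≡ true
    ⌊∙≟ε⌋ x≟e y≟e rewrite ⌊≟⌋-true⁻ _≟_ x≟e | ⌊≟⌋-true⁻ _≟_ y≟e | identityˡ e = ⌊≟⌋-refl _≟_ e

    subsetᵇ-true : ∀ (A B : Sub H) → _⊆ˢ_ H A B → subsetᵇ H A B ≡ true
    subsetᵇ-true A B A⊆B = cong not (anyᵇ-false⁺ _ elems A∖B-empty)
      where
      A∖B-empty : ∀ x → A x ∧ not (B x) ≡ false
      A∖B-empty x with A x in Ax
      ... | false = refl
      ... | true rewrite A⊆B x Ax = refl

    subsetᵇ-false : ∀ (A B : Sub H) {x} → A x ≡ true → B x ≡ false → subsetᵇ H A B ≡ false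
    subsetᵇ-false A B {x} Ax ¬Bx = cong not (anyᵇ-true⁺ _ elems (complete x) (cong₂ _∧_ Ax (cong not ¬Bx)))

    eqSubᵇ-true : ∀ (A B : Sub H) → (∀ x → A x ≡ B x) → eqSubᵇ H A B ≡ true
    eqSubᵇ-true A B A≗B = cong₂ _∧_ (subsetᵇ-true A B (λ x Ax → trans (sym (A≗B x)) Ax))
                                    (subsetᵇ-true B A (λ x Bx → trans (A≗B x) Bx))

    eqSubᵇ-false : ∀ (A B : Sub H) {x} → A x ≡ true → B x ≡ false → eqSubᵇ H A B ≡ false
    eqSubᵇ-false A B Ax ¬Bx = cong (_∧ subsetᵇ H B A) (subsetᵇ-false A B Ax ¬Bx)

    ·K-intro : ∀ (A B : Sub H) {x k} → B k ≡ true → A (x // k) ≡ true → _·K_ H A B x ≡ true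
    ·K-intro A B {x} {k} Bk Ax//k = anyᵇ-true⁺ _ elems (complete k) (cong₂ _∧_ Bk Ax//k)

    ·K-elim : ∀ (A B : Sub H) {x} → _·K_ H A B x ≡ true → Σ Carrier λ k → B k ≡ true × A (x // k) ≡ true
    ·K-elim A B {x} AB-x with anyᵇ-true⁻ _ elems AB-x
    ... | k , Bk∧Ax//k = k , ∧-true⁻ Bk∧Ax//k

    ∑ : (Carrier → ℤ) → ℤ
    ∑ f = sumℤ f elems

    infixl 7 _⋆_
    _⋆_ : ℤ[H] H → ℤ[H] H → ℤ[H] H
    _⋆_ = _⊛_ H

    𝟙 : ℤ[H] H
    𝟙 _ = + 1

    ∑-reindex : (h : Carrier → Carrier) → Injective _≡_ _≡_ h → StrictlySurjective _≡_ h →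
                (f : Carrier → ℤ) → ∑ (f ∘ h) ≡ ∑ f
    ∑-reindex = sumℤ-bijection _≟_ _≟_ unique complete unique complete

    ∑-\\ʳ : ∀ g (f : Carrier → ℤ) → ∑ (λ a → f (a \\ g)) ≡ ∑ f
    ∑-\\ʳ g = ∑-reindex (_\\ g) (\\ʳ-injective g) (λ b → g // b , [x//y]\\x≡y g b)

    ∑-\\ˡ : ∀ y (f : Carrier → ℤ) → ∑ (λ x → f (y \\ x)) ≡ ∑ f
    ∑-\\ˡ y = ∑-reindex (y \\_) inj (λ b → y ∙ b , \\-leftDividesʳ y b)
      where
      inj : Injective _≡_ _≡_ (y \\_)
      inj {a} {a′} eq = trans (sym (\\-leftDividesˡ y a)) (trans (cong (y ∙_) eq) (\\-leftDividesˡ y a′))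

    ∑-⋆ : ∀ (f g : ℤ[H] H) → ∑ (f ⋆ g) ≡ ∑ f * ∑ g
    ∑-⋆ f g = begin
      ∑ (λ x → ∑ (λ y → f y * g (y \\ x)))   ≡⟨ sumℤ-comm elems elems (λ x y → f y * g (y \\ x)) ⟩
      ∑ (λ y → ∑ (λ x → f y * g (y \\ x)))
        ≡⟨ sumℤ-cong elems (λ y → trans (sumℤ-*ˡ elems (f y) _) (cong (f y *_) (∑-\\ˡ y g))) ⟩
      ∑ (λ y → f y * ∑ g)                    ≡⟨ sumℤ-*ʳ elems (∑ g) f ⟩
      ∑ f * ∑ g                              ∎
      where open ≡-Reasoning

    𝟙⋆ : ∀ (f : ℤ[H] H) x → (𝟙 ⋆ f) x ≡ ∑ f
    𝟙⋆ f x = trans (sumℤ-cong elems (λ y → ℤₚ.*-identityˡ _)) (∑-\\ʳ x f)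

    ⋆𝟙 : ∀ (f : ℤ[H] H) x → (f ⋆ 𝟙) x ≡ ∑ f
    ⋆𝟙 f x = sumℤ-cong elems (λ y → ℤₚ.*-identityʳ _)

    δₑ-// : ∀ x y → δ e (x // y) ≡ δ y x
    δₑ-// x y with (x // y) ≟ e | x ≟ y
    ... | yes _      | yes _    = refl
    ... | no _       | no _     = refl
    ... | yes x//y≡ε | no x≢y   = ⊥-elim (x≢y (x∙y⁻¹≈ε⇒x≈y x y x//y≡ε))
    ... | no x//y≢ε  | yes refl = ⊥-elim (x//y≢ε (inverseʳ x))

    δₑ-\\ : ∀ y x → δ e (y \\ x) ≡ δ x y
    δₑ-\\ y x with (y \\ x) ≟ e | y ≟ x
    ... | yes _        | yes _    = refl
    ... | no _         | no _     = refl
    ... | yes y\\x≡ε   | no y≢x   = ⊥-elim (y≢x (x\\y≡ε⇒x≡y y x y\\x≡ε))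
    ... | no y\\x≢ε    | yes refl = ⊥-elim (y\\x≢ε (inverseˡ y))

    ⋆-identityʳ : ∀ (f : ℤ[H] H) x → (f ⋆ δ e) x ≡ f x
    ⋆-identityʳ f x = trans (sumℤ-cong elems (λ y → trans (ℤₚ.*-comm (f y) _) (cong (_* f y) (δₑ-\\ y x))))
                            (sumℤ-δ unique (complete x) f)

    ⋆-identityˡ : ∀ (f : ℤ[H] H) x → (δ e ⋆ f) x ≡ f x
    ⋆-identityˡ f x = trans (sumℤ-δ unique (complete e) (λ y → f (y \\ x))) (cong f (ε\\x≡x x))

    ⋆-cong : ∀ {f f′ g g′ : ℤ[H] H} → (∀ y → f y ≡ f′ y) → (∀ y → g y ≡ g′ y) →
             ∀ x → (f ⋆ g) x ≡ (f′ ⋆ g′) x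
    ⋆-cong f≗f′ g≗g′ x = sumℤ-cong elems (λ y → cong₂ _*_ (f≗f′ y) (g≗g′ _))

    ⋆-distribˡ-- : ∀ (f g g′ : ℤ[H] H) x → (f ⋆ (λ y → g y - g′ y)) x ≡ (f ⋆ g) x - (f ⋆ g′) x
    ⋆-distribˡ-- f g g′ x = trans (sumℤ-cong elems (λ y → *-distribˡ-- (f y) (g _) (g′ _))) (sumℤ-- elems _ _)

    ⋆-bilinear : ∀ {I : Set} (is : List I) (c d : I → ℤ) (B : I → ℤ[H] H) x →
      ((λ y → sumℤ (λ k → c k * B k y) is) ⋆ (λ y → sumℤ (λ l → d l * B l y) is)) x
      ≡ sumℤ (λ k → sumℤ (λ l → (c k * d l) * (B k ⋆ B l) x) is) is
    ⋆-bilinear is c d B x = begin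
      ∑ (λ y → sumℤ (λ k → c k * B k y) is * sumℤ (λ l → d l * B l (y \\ x)) is)
        ≡⟨ sumℤ-cong elems (λ y → sumℤ-*-sumℤ is is _ _) ⟩
      ∑ (λ y → sumℤ (λ k → sumℤ (λ l → (c k * B k y) * (d l * B l (y \\ x))) is) is)
        ≡⟨ sumℤ-comm elems is _ ⟩
      sumℤ (λ k → ∑ (λ y → sumℤ (λ l → (c k * B k y) * (d l * B l (y \\ x))) is)) is
        ≡⟨ sumℤ-cong is (λ k → sumℤ-comm elems is _) ⟩
      sumℤ (λ k → sumℤ (λ l → ∑ (λ y → (c k * B k y) * (d l * B l (y \\ x)))) is) is
        ≡⟨ sumℤ-cong is (λ k → sumℤ-cong is (λ l →
             trans (sumℤ-cong elems (λ y → interchange (c k) (B k y) (d l) _)) (sumℤ-*ˡ elems (c k * d l) _))) ⟩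
      sumℤ (λ k → sumℤ (λ l → (c k * d l) * (B k ⋆ B l) x) is) is
        ∎
      where open ≡-Reasoning
            open CommSemigroupProperties ℤₚ.*-commutativeSemigroup using (interchange)

    ∑⟦⟧≤1 : ∀ (P : Carrier → Bool) → (∀ a b → P a ≡ true → P b ≡ true → a ≡ b) → ∑ (λ x → ⟦ P x ⟧) ≤ + 1
    ∑⟦⟧≤1 P = sumℤ⟦⟧≤1 P unique

    ∑≡∑𝟙⇒≡1 : ∀ (f : Carrier → ℤ) → (∀ x → f x ≤ + 1) → ∑ f ≡ ∑ 𝟙 → ∀ x → f x ≡ + 1
    ∑≡∑𝟙⇒≡1 f f≤1 Σf≡ x = sumℤ≡length⇒≡1 f elems f≤1 (trans Σf≡ (sumℤ-one elems)) (complete x)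

    ∃-false : ∀ (P : Carrier → Bool) → ∑ (λ x → ⟦ P x ⟧) ≢ ∑ 𝟙 → Σ Carrier λ x → P x ≡ false
    ∃-false P ∑P≢∑𝟙 with anyᵇ (not ∘ P) elems in any¬P
    ... | false = ⊥-elim (∑P≢∑𝟙 (sumℤ-cong elems (λ x → cong ⟦_⟧ (P-true x))))
      where
      P-true : ∀ x → P x ≡ true
      P-true x with P x in Px
      ... | true  = refl
      ... | false with trans (sym any¬P) (anyᵇ-true⁺ (not ∘ P) elems (complete x) (cong not Px))
      ...   | ()
    ... | true with anyᵇ-true⁻ (not ∘ P) elems any¬P
    ...   | x , ¬Px = x , not-injective ¬Px
      where not-injective : ∀ {b} → not b ≡ true → b ≡ false
            not-injective {false} _ = refl

    ∃-≢ : ∀ (P : Carrier → Bool) c → + 1 ℤ.< ∑ (λ x → ⟦ P x ⟧) → Σ Carrier λ x → P x ≡ true × x ≢ c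
    ∃-≢ P c 1<∑P with anyᵇ (λ x → P x ∧ not ⌊ x ≟ c ⌋) elems in any
    ... | false = ⊥-elim (ℤₚ.<⇒≱ 1<∑P (∑⟦⟧≤1 P (λ a b Pa Pb → trans (≡c a Pa) (sym (≡c b Pb)))))
      where
      ≡c : ∀ x → P x ≡ true → x ≡ c
      ≡c x Px with x ≟ c
      ... | yes x≡c = x≡c
      ... | no x≢c with trans (sym any)
                              (anyᵇ-true⁺ _ elems (complete x) (cong₂ _∧_ Px (cong not (⌊≟⌋-≢ _≟_ x≢c))))
      ...   | ()
    ... | true with anyᵇ-true⁻ _ elems any
    ...   | x , Px∧x≢c with ∧-true⁻ {P x} Px∧x≢c
    ...     | Px , x≢c = x , Px , ⌊≟⌋-false⁻ _≟_ x≢c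

  -- Semiregular relative difference sets

  module SemiregularRDS (G : FinGroup) (N : Sub G) (N≤G : IsSubgroup G N) (n λ' : ℕ)
                        (∣G∣≡ : ∣H∣ G ≡ n ℕ.* λ' ℕ.* n) (∣N∣≡ : ∣_∣ˢ G N ≡ n) where
    open FinGroupProperties G

    𝟙N : ℤ[H] G
    𝟙N a = ⟦ N a ⟧

    ∑𝟙N : ∑ 𝟙N ≡ + n
    ∑𝟙N = trans (sym (count≡sumℤ N elems)) (cong +_ ∣N∣≡)

    ∑𝟙 : ∑ 𝟙 ≡ + (n ℕ.* λ' ℕ.* n)
    ∑𝟙 = trans (sym (count≡sumℤ (λ _ → true) elems)) (cong +_ ∣G∣≡)

    N-ε : N e ≡ true
    N-ε = proj₁ N≤G

    N-∙ : ∀ x y → N x ≡ true → N y ≡ true → N (x ∙ y) ≡ true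
    N-∙ = proj₁ (proj₂ N≤G)

    N-⁻¹ : ∀ x → N x ≡ true → N (x ⁻¹) ≡ true
    N-⁻¹ = proj₂ (proj₂ N≤G)

    N-\\ : ∀ x y → N x ≡ true → N y ≡ true → N (x \\ y) ≡ true
    N-\\ x y Nx = N-∙ (x ⁻¹) y (N-⁻¹ x Nx)

    N-// : ∀ x y → N x ≡ true → N y ≡ true → N (x // y) ≡ true
    N-// x y Nx Ny = N-∙ x (y ⁻¹) Nx (N-⁻¹ y Ny)

    N-⁻¹≡ : ∀ x → N (x ⁻¹) ≡ N x
    N-⁻¹≡ x = T⇔T⇒≡ (λ Nx⁻¹ → subst (λ y → N y ≡ true) (⁻¹-involutive x) (N-⁻¹ _ Nx⁻¹)) (N-⁻¹ x)

    N-\\≡ : ∀ a g → N a ≡ true → N (a \\ g) ≡ N g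
    N-\\≡ a g Na = T⇔T⇒≡ (λ Na\\g → subst (λ y → N y ≡ true) (\\-leftDividesˡ a g) (N-∙ a _ Na Na\\g))
                         (N-\\ a g Na)

    𝟙N⋆𝟙N : ∀ g → (𝟙N ⋆ 𝟙N) g ≡ + n * 𝟙N g
    𝟙N⋆𝟙N g = trans (sumℤ-cong elems term) (trans (sumℤ-*ʳ elems (𝟙N g) 𝟙N) (cong (_* 𝟙N g) ∑𝟙N))
      where
      term : ∀ a → 𝟙N a * 𝟙N (a \\ g) ≡ 𝟙N a * 𝟙N g
      term a with N a in Na
      ... | true  = cong (λ b → + 1 * ⟦ b ⟧) (N-\\≡ a g Na)
      ... | false = refl

    RDSEquation : Sub G → ℕ → Set
    RDSEquation Y k = _≈ᴿ_ G (_⊛_ G (ul G Y) (ul G (inv G Y)))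
                             (_⊕_ G (_·ℤ_ G (+ k) (ul G (singleton G e)))
                                    (_·ℤ_ G (+ λ') (ul G (_∖ˢ_ G (whole G) N))))

    MeetsRightCosetsAtMostOnce : Sub G → Set
    MeetsRightCosetsAtMostOnce Y = ∀ p q → Y p ≡ true → Y q ≡ true → N (p // q) ≡ true → p ≡ q

    MeetsLeftCosetsAtMostOnce : Sub G → Set
    MeetsLeftCosetsAtMostOnce Y = ∀ p q → Y p ≡ true → Y q ≡ true → N (p \\ q) ≡ true → p ≡ q

    -- For p ≠ q in Y with p q⁻¹ ∈ N, the pair (p , q) contributes to the coefficient of p q⁻¹
    -- in Y Y⁽⁻¹⁾, which the RDS equation forces to be 0.
    rds⇒meetsRightCosetsAtMostOnce : ∀ Y k → RDSEquation Y k → MeetsRightCosetsAtMostOnce Y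
    rds⇒meetsRightCosetsAtMostOnce Y k eqn p q Yp Yq Np//q with p ≟ q
    ... | yes p≡q = p≡q
    ... | no p≢q  =
      ⊥-elim (ℤₚ.<⇒≱ (ℤ.+<+ (ℕ.s≤s ℕ.z≤n)) (ℤₚ.≤-trans 1≤lhs (ℤₚ.≤-reflexive (trans (eqn x) rhs≡0))))
      where
      x = p // q
      rhs≡0 : + k * ⟦ ⌊ x ≟ e ⌋ ⟧ + + λ' * ⟦ not (N x) ⟧ ≡ + 0
      rhs≡0 rewrite Np//q | ⌊≟⌋-≢ _≟_ (p≢q ∘ x∙y⁻¹≈ε⇒x≈y p q) =
        cong₂ _+_ (ℤₚ.*-zeroʳ (+ k)) (ℤₚ.*-zeroʳ (+ λ'))
      term≡1 : ⟦ Y p ⟧ * ⟦ Y ((p \\ x) ⁻¹) ⟧ ≡ + 1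
      term≡1 rewrite \\-leftDividesʳ p (q ⁻¹) | ⁻¹-involutive q | Yp | Yq = refl
      1≤lhs : + 1 ≤ (_⊛_ G (ul G Y) (ul G (inv G Y))) x
      1≤lhs = ℤₚ.≤-trans (ℤₚ.≤-reflexive (sym term≡1))
                (≤-sumℤ elems (λ y → ⟦ Y y ⟧ * ⟦ Y ((y \\ x) ⁻¹) ⟧)
                   (λ y → subst (+ 0 ≤_) (sym (⟦⟧-∧ (Y y) _)) (⟦⟧-nonneg _)) (complete p))

    meetsRight⁻¹⇒meetsLeft : ∀ Y Y′ → _≐_ G (inv G Y) Y′ →
                             MeetsRightCosetsAtMostOnce Y′ → MeetsLeftCosetsAtMostOnce Y
    meetsRight⁻¹⇒meetsLeft Y Y′ Y⁻¹≐Y′ right p q Yp Yq Np\\q =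
      ⁻¹-injective (right (p ⁻¹) (q ⁻¹) (Y′-⁻¹ p Yp) (Y′-⁻¹ q Yq)
                          (subst (λ y → N (p ⁻¹ ∙ y) ≡ true) (sym (⁻¹-involutive q)) Np\\q))
      where
      Y′-⁻¹ : ∀ z → Y z ≡ true → Y′ (z ⁻¹) ≡ true
      Y′-⁻¹ z Yz = trans (sym (Y⁻¹≐Y′ (z ⁻¹))) (trans (cong Y (⁻¹-involutive z)) Yz)

    -- A set of size |G : N| meeting every coset of N at most once meets each exactly once.
    module Transversal (Y : Sub G) (∣Y∣≡ : ∣_∣ˢ G Y ≡ n ℕ.* λ')
                       (right : MeetsRightCosetsAtMostOnce Y) (left : MeetsLeftCosetsAtMostOnce Y) where

      𝟙Y : ℤ[H] G
      𝟙Y a = ⟦ Y a ⟧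

      ∑𝟙Y : ∑ 𝟙Y ≡ + (n ℕ.* λ')
      ∑𝟙Y = trans (sym (count≡sumℤ Y elems)) (cong +_ ∣Y∣≡)

      ∑𝟙N*∑𝟙Y : ∑ 𝟙N * ∑ 𝟙Y ≡ ∑ 𝟙
      ∑𝟙N*∑𝟙Y = begin
        ∑ 𝟙N * ∑ 𝟙Y              ≡⟨ cong₂ _*_ ∑𝟙N ∑𝟙Y ⟩
        + n * + (n ℕ.* λ')       ≡⟨ ℤₚ.pos-* n (n ℕ.* λ') ⟨
        + (n ℕ.* (n ℕ.* λ'))     ≡⟨ cong +_ (ℕₚ.*-comm n (n ℕ.* λ')) ⟩
        + (n ℕ.* λ' ℕ.* n)       ≡⟨ ∑𝟙 ⟨
        ∑ 𝟙                      ∎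
        where open ≡-Reasoning

      𝟙N⋆𝟙Y : ∀ g → (𝟙N ⋆ 𝟙Y) g ≡ + 1
      𝟙N⋆𝟙Y = ∑≡∑𝟙⇒≡1 (𝟙N ⋆ 𝟙Y) ≤1 (trans (∑-⋆ 𝟙N 𝟙Y) ∑𝟙N*∑𝟙Y)
        where
        ≤1 : ∀ g → (𝟙N ⋆ 𝟙Y) g ≤ + 1
        ≤1 g = ℤₚ.≤-trans (ℤₚ.≤-reflexive (sumℤ-cong elems (λ a → ⟦⟧-∧ (N a) (Y (a \\ g)))))
                          (∑⟦⟧≤1 (λ a → N a ∧ Y (a \\ g)) unique-a)
          where
          unique-a : ∀ a b → N a ∧ Y (a \\ g) ≡ true → N b ∧ Y (b \\ g) ≡ true → a ≡ b
          unique-a a b h h′ with ∧-true⁻ h | ∧-true⁻ h′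
          ... | Na , Ya\\g | Nb , Yb\\g =
            \\ʳ-injective g (right _ _ Ya\\g Yb\\g
              (subst (λ y → N y ≡ true) (sym ([x\\z]//[y\\z]≡x\\y a b g)) (N-\\ a b Na Nb)))

      𝟙Y⋆𝟙N : ∀ g → (𝟙Y ⋆ 𝟙N) g ≡ + 1
      𝟙Y⋆𝟙N = ∑≡∑𝟙⇒≡1 (𝟙Y ⋆ 𝟙N) ≤1 (trans (∑-⋆ 𝟙Y 𝟙N) (trans (ℤₚ.*-comm (∑ 𝟙Y) (∑ 𝟙N)) ∑𝟙N*∑𝟙Y))
        where
        ≤1 : ∀ g → (𝟙Y ⋆ 𝟙N) g ≤ + 1
        ≤1 g = ℤₚ.≤-trans (ℤₚ.≤-reflexive (sumℤ-cong elems (λ a → ⟦⟧-∧ (Y a) (N (a \\ g)))))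
                          (∑⟦⟧≤1 (λ a → Y a ∧ N (a \\ g)) unique-a)
          where
          unique-a : ∀ a b → Y a ∧ N (a \\ g) ≡ true → Y b ∧ N (b \\ g) ≡ true → a ≡ b
          unique-a a b h h′ with ∧-true⁻ h | ∧-true⁻ h′
          ... | Ya , Na\\g | Yb , Nb\\g =
            left a b Ya Yb (subst (λ y → N y ≡ true) ([x\\z]//[y\\z]≡x\\y a b g) (N-// _ _ Na\\g Nb\\g))

      meets-every-coset : ∀ b → Σ Carrier λ l → N l ≡ true × Y (b // l) ≡ true
      meets-every-coset b with sumℤ⟦⟧-≢0 (λ a → Y a ∧ N (a \\ b)) elems ∑≢0
        where ∑≢0 : ∑ (λ a → ⟦ Y a ∧ N (a \\ b) ⟧) ≢ + 0
              ∑≢0 ∑≡0 with trans (sym (𝟙Y⋆𝟙N b))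
                                 (trans (sumℤ-cong elems (λ a → ⟦⟧-∧ (Y a) (N (a \\ b)))) ∑≡0)
              ... | ()
      ... | a , h with ∧-true⁻ h
      ...   | Ya , Na\\b = a \\ b , Na\\b , subst (λ y → Y y ≡ true) (sym (x//[y\\x]≡y b a)) Ya

      misses-every-coset : ∀ {l₀} → N l₀ ≡ true → l₀ ≢ e →
                           ∀ b → Σ Carrier λ l → N l ≡ true × Y (b // l) ≡ false
      misses-every-coset {l₀} Nl₀ l₀≢e b with Y (b // e) in Yb
      ... | false = e , N-ε , Yb
      ... | true with Y (b // l₀) in Yb//l₀
      ...   | false = l₀ , Nl₀ , Yb//l₀
      ...   | true  = ⊥-elim (l₀≢e (⁻¹-injective (trans l₀⁻¹≡ε (sym ε⁻¹≈ε))))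
        where
        b≡b//l₀ : b ≡ b // l₀
        b≡b//l₀ = left b (b // l₀) (subst (λ y → Y y ≡ true) (x//ε≡x b) Yb)
                    Yb//l₀ (subst (λ y → N y ≡ true) (sym (\\-leftDividesʳ b (l₀ ⁻¹))) (N-⁻¹ l₀ Nl₀))
        l₀⁻¹≡ε : l₀ ⁻¹ ≡ e
        l₀⁻¹≡ε = trans (sym (\\-leftDividesʳ b (l₀ ⁻¹))) (trans (cong (b \\_) (sym b≡b//l₀)) (inverseˡ b))

  -- Isomorphisms onto the associated group of a closed linked system

  module AssociatedGroupIso (U : FinGroup) {W : Set} (_≟W_ : DecidableEquality W)
      (χ : W → W) (ψ : (α β : W) → .(β ≢ χ α) → W)
      (φ : FinGroup.Carrier U → Maybe W) (φ-bijective : Bijective _≡_ _≡_ φ)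
      (φ-hom : ∀ u v → φ (FinGroup._∙_ U u v) ≡ ψ̂ _≟W_ χ ψ (φ u) (φ v)) where
    open FinGroupProperties U

    φ-injective : Injective _≡_ _≡_ φ
    φ-injective = proj₁ φ-bijective

    φ-surjective : StrictlySurjective _≡_ φ
    φ-surjective m with proj₂ φ-bijective m
    ... | u , φu≡m = u , φu≡m refl

    φ-ε : φ e ≡ nothing
    φ-ε with φ-surjective nothing
    ... | u , φu≡∞ = begin
      φ e                        ≡⟨ ψ̂-identityʳ (φ e) ⟨
      ψ̂ _≟W_ χ ψ (φ e) nothing   ≡⟨ cong (ψ̂ _≟W_ χ ψ (φ e)) φu≡∞ ⟨
      ψ̂ _≟W_ χ ψ (φ e) (φ u)     ≡⟨ φ-hom e u ⟨
      φ (e ∙ u)                  ≡⟨ cong φ (identityˡ u) ⟩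
      φ u                        ≡⟨ φu≡∞ ⟩
      nothing                    ∎
      where
      open ≡-Reasoning
      ψ̂-identityʳ : ∀ m → ψ̂ _≟W_ χ ψ m nothing ≡ m
      ψ̂-identityʳ nothing  = refl
      ψ̂-identityʳ (just _) = refl

    φ-∞⇒ε : ∀ {u} → φ u ≡ nothing → u ≡ e
    φ-∞⇒ε φu≡∞ = φ-injective (trans φu≡∞ (sym φ-ε))

    φ-≢ε : ∀ {u} → u ≢ e → Σ W λ α → φ u ≡ just α
    φ-≢ε {u} u≢e with φ u in φu
    ... | just α  = α , refl
    ... | nothing = ⊥-elim (u≢e (φ-∞⇒ε φu))

    φ-just⇒≢ε : ∀ {u α} → φ u ≡ just α → u ≢ e
    φ-just⇒≢ε φu≡α refl with trans (sym φu≡α) φ-ε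
    ... | ()

    φ-⁻¹ : ∀ {u α} → φ u ≡ just α → φ (u ⁻¹) ≡ just (χ α)
    φ-⁻¹ {u} {α} φu≡α with φ (u ⁻¹) in φu⁻¹
                         | trans (sym φ-ε) (trans (cong φ (sym (inverseʳ u))) (φ-hom u (u ⁻¹)))
    ... | nothing | _ =
      ⊥-elim (φ-just⇒≢ε φu≡α (trans (sym (⁻¹-involutive u)) (trans (cong _⁻¹ (φ-∞⇒ε φu⁻¹)) ε⁻¹≈ε)))
    ... | just β  | ∞≡ψ̂ rewrite φu≡α with β ≟W χ α
    ...   | yes β≡χα = cong just β≡χα
    ...   | no _     with ∞≡ψ̂
    ...     | ()

    φ-∙ : ∀ {u v α β γ} → φ u ≡ just α → φ v ≡ just β → φ (u ∙ v) ≡ just γ →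
          Σ (β ≢ χ α) λ β≢χα → ψ α β β≢χα ≡ γ
    φ-∙ {u} {v} {α} {β} φu≡α φv≡β φuv≡γ with trans (sym φuv≡γ) (φ-hom u v)
    ... | γ≡ψ̂ rewrite φu≡α | φv≡β with β ≟W χ α
    ...   | no β≢χα = β≢χα , just-injective (sym γ≡ψ̂)
      where just-injective : ∀ {a b : W} → just a ≡ just b → a ≡ b
            just-injective refl = refl
    ...   | yes _ with γ≡ψ̂
    ...     | ()

    ∣U∣≡ : ∀ {Welems w} → (∀ α → α ∈ Welems) → Unique Welems → length Welems ≡ w → length elems ≡ suc w
    ∣U∣≡ {Welems} {w} W-complete W-unique ∣W∣≡ = ℤₚ.+-injective (begin
      + length elems                 ≡⟨ sumℤ-one elems ⟨
      sumℤ (λ _ → + 1) elems         ≡⟨ sumℤ-bijection _≟_ (Maybeₚ.≡-dec _≟W_) unique complete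
                                          W∞-unique W∞-complete φ φ-injective φ-surjective (λ _ → + 1) ⟩
      sumℤ (λ _ → + 1) W∞            ≡⟨ sumℤ-one W∞ ⟩
      + suc (length (map just Welems)) ≡⟨ cong (+_ ∘ suc) (trans (Listₚ.length-map just Welems) ∣W∣≡) ⟩
      + suc w                        ∎)
      where
      open ≡-Reasoning
      W∞ : List (Maybe W)
      W∞ = nothing ∷ map just Welems
      W∞-complete : ∀ m → m ∈ W∞
      W∞-complete nothing  = here refl
      W∞-complete (just α) = there (∈-map⁺ just (W-complete α))
      W∞-unique : Unique W∞
      W∞-unique = All.tabulate ∞∉ ∷ Uniqueₚ.map⁺ (λ { refl → refl }) W-unique
        where
        ∞∉ : ∀ {m} → m ∈ map just Welems → nothing ≢ m
        ∞∉ m∈ refl with ∈-map⁻ just m∈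
        ... | _ , _ , ()

  -- Layered functions on G × U

  module Layers (G U : FinGroup) (w : ℕ) (∣U∣≡ : length (FinGroup.elems U) ≡ suc w) where
    module G = FinGroupProperties G
    module U = FinGroupProperties U

    H : FinGroup
    H = G ⊗ U

    module H = FinGroupProperties H

    δ₀ : U.Carrier → ℤ
    δ₀ = U.δ U.e

    δ* : U.Carrier → ℤ
    δ* u = + 1 - δ₀ u

    layered : (U.Carrier → ℤ) → (U.Carrier → ℤ[H] G) → ℤ[H] H
    layered c s (a , u) = c u * s u a

    ∑δ₀ : sumℤ δ₀ U.elems ≡ + 1
    ∑δ₀ = trans (sumℤ-cong U.elems (λ u → sym (ℤₚ.*-identityʳ (δ₀ u))))
                (U.sumℤ-δ U.unique (U.complete U.e) (λ _ → + 1))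

    ∑δ* : sumℤ δ* U.elems ≡ + w
    ∑δ* = begin
      sumℤ δ* U.elems                                    ≡⟨ sumℤ-- U.elems (λ _ → + 1) δ₀ ⟩
      sumℤ (λ _ → + 1) U.elems - sumℤ δ₀ U.elems         ≡⟨ cong₂ _-_ (trans (sumℤ-one U.elems) (cong +_ ∣U∣≡)) ∑δ₀ ⟩
      + suc w - + 1                                      ≡⟨ +[m∸1]≡+m-1 (ℕ.s≤s ℕ.z≤n) ⟨
      + w                                                ∎
      where open ≡-Reasoning

    δ*-*-cong : ∀ z {a b} → (z ≢ U.e → a ≡ b) → δ* z * a ≡ δ* z * b
    δ*-*-cong z a≡b with U.δ-cases U.e z
    ... | inj₁ (_ , δ₀z≡1)   rewrite δ₀z≡1 = refl
    ... | inj₂ (z≢e , _)     = cong (δ* z *_) (a≡b z≢e)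

    ⋆-⊗ : ∀ (F F′ : ℤ[H] H) g z →
          (F H.⋆ F′) (g , z) ≡ sumℤ (λ u → G.∑ (λ a → F (a , u) * F′ (a G.\\ g , u U.\\ z))) U.elems
    ⋆-⊗ F F′ g z = trans (sumℤ-cartesianProduct G.elems U.elems (λ p → F p * F′ (p H.\\ (g , z))))
                         (sumℤ-comm G.elems U.elems (λ a u → F (a , u) * F′ (a G.\\ g , u U.\\ z)))

    count-by-layers : ∀ (P : Sub H) → + ∣_∣ˢ H P ≡ sumℤ (λ u → G.∑ (λ g → ⟦ P (g , u) ⟧)) U.elems
    count-by-layers P = trans (count≡sumℤ P H.elems)
      (trans (sumℤ-cartesianProduct G.elems U.elems (λ x → ⟦ P x ⟧))
             (sumℤ-comm G.elems U.elems (λ g u → ⟦ P (g , u) ⟧)))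

    layered-⋆ : ∀ (c c′ : U.Carrier → ℤ) (s s′ : U.Carrier → ℤ[H] G) g z →
      (layered c s H.⋆ layered c′ s′) (g , z)
      ≡ sumℤ (λ u → (c u * c′ (u U.\\ z)) * (s u G.⋆ s′ (u U.\\ z)) g) U.elems
    layered-⋆ c c′ s s′ g z = trans (⋆-⊗ (layered c s) (layered c′ s′) g z)
      (sumℤ-cong U.elems (λ u → trans (sumℤ-cong G.elems (λ a → interchange (c u) (s u a) (c′ (u U.\\ z)) _))
                                      (sumℤ-*ˡ G.elems (c u * c′ (u U.\\ z)) _)))
      where open CommSemigroupProperties ℤₚ.*-commutativeSemigroup using (interchange)

    ∑-δ₀-· : ∀ (c : U.Carrier → ℤ) (F : U.Carrier → ℤ) z →
             sumℤ (λ u → (δ₀ u * c (u U.\\ z)) * F u) U.elems ≡ c z * F U.e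
    ∑-δ₀-· c F z = trans (sumℤ-cong U.elems (λ u → ℤₚ.*-assoc (δ₀ u) _ _))
      (trans (U.sumℤ-δ U.unique (U.complete U.e) (λ u → c (u U.\\ z) * F u))
             (cong (λ v → c v * F U.e) (U.ε\\x≡x z)))

    ∑-·-δ₀ : ∀ (c : U.Carrier → ℤ) (F : U.Carrier → ℤ) z →
             sumℤ (λ u → (c u * δ₀ (u U.\\ z)) * F u) U.elems ≡ c z * F z
    ∑-·-δ₀ c F z = trans (sumℤ-cong U.elems term) (U.sumℤ-δ U.unique (U.complete z) (λ u → c u * F u))
      where
      term : ∀ u → (c u * δ₀ (u U.\\ z)) * F u ≡ U.δ z u * (c u * F u)
      term u rewrite U.δₑ-\\ u z = trans (cong (_* F u) (ℤₚ.*-comm (c u) (U.δ z u))) (ℤₚ.*-assoc (U.δ z u) _ _)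

    -- Only u ∉ {e , z} contribute, and there are w - 1 + δ₀ z = w - δ* z of them.
    ∑-δ*-δ* : ∀ (F : U.Carrier → ℤ) z C → (∀ u → u ≢ U.e → u ≢ z → F u ≡ C) →
              sumℤ (λ u → (δ* u * δ* (u U.\\ z)) * F u) U.elems ≡ (+ w - δ* z) * C
    ∑-δ*-δ* F z C F≡C = begin
      sumℤ (λ u → (δ* u * δ* (u U.\\ z)) * F u) U.elems       ≡⟨ sumℤ-cong U.elems term ⟩
      sumℤ (λ u → (δ* u - U.δ z u * δ* u) * C) U.elems        ≡⟨ sumℤ-*ʳ U.elems C _ ⟩
      sumℤ (λ u → δ* u - U.δ z u * δ* u) U.elems * C          ≡⟨ cong (_* C) (sumℤ-- U.elems δ* _) ⟩
      (sumℤ δ* U.elems - sumℤ (λ u → U.δ z u * δ* u) U.elems) * C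
        ≡⟨ cong (_* C) (cong₂ _-_ ∑δ* (U.sumℤ-δ U.unique (U.complete z) δ*)) ⟩
      (+ w - δ* z) * C                                        ∎
      where
      open ≡-Reasoning
      term : ∀ u → (δ* u * δ* (u U.\\ z)) * F u ≡ (δ* u - U.δ z u * δ* u) * C
      term u rewrite U.δₑ-\\ u z with U.δ-cases U.e u | U.δ-cases z u
      ... | inj₁ (_ , δ₀u≡1) | _ rewrite δ₀u≡1 = u≡e (U.δ z u) (F u) C
        where u≡e : ∀ b f c → ((+ 1 - + 1) * (+ 1 - b)) * f ≡ ((+ 1 - + 1) - b * (+ 1 - + 1)) * c
              u≡e = solve-∀
      ... | inj₂ _ | inj₁ (_ , δzu≡1) rewrite δzu≡1 = u≡z (δ* u) (F u) C
        where u≡z : ∀ a f c → (a * (+ 1 - + 1)) * f ≡ (a - + 1 * a) * c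
              u≡z = solve-∀
      ... | inj₂ (u≢e , _) | inj₂ (u≢z , δzu≡0) rewrite δzu≡0 | F≡C u u≢e u≢z = otherwise (δ* u) C
        where otherwise : ∀ a c → (a * (+ 1 - + 0)) * c ≡ (a - + 0 * a) * c
              otherwise = solve-∀

  -- The S-ring over G × U

  module Construction
      (G U : FinGroup) (W : Set) (_≟W_ : DecidableEquality W) (Welems : List W)
      (N : Sub G) (X : W → Sub G) (χ : W → W) (ψ : (α β : W) → .(β ≢ χ α) → W)
      (n λ' w μ ν : ℕ) (2≤n : 2 ℕ.≤ n)
      (linked : IsClosedLinkedSystem G W _≟W_ Welems N X χ ψ (n ℕ.* λ') n (n ℕ.* λ') λ' w μ ν)
      (φ : FinGroup.Carrier U → Maybe W) (φ-bijective : Bijective _≡_ _≡_ φ)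
      (φ-hom : ∀ u v → φ (FinGroup._∙_ U u v) ≡ ψ̂ _≟W_ χ ψ (φ u) (φ v)) where

    W-complete : ∀ α → α ∈ Welems
    W-complete = proj₁ (proj₁ linked)

    W-unique : Unique Welems
    W-unique = proj₁ (proj₂ (proj₁ linked))

    ∣W∣≡w : length Welems ≡ w
    ∣W∣≡w = proj₂ (proj₂ (proj₁ linked))

    2≤w : 2 ℕ.≤ w
    2≤w = proj₁ (proj₂ linked)

    X-rds : ∀ α → IsRDS G N (X α) (n ℕ.* λ') n (n ℕ.* λ') λ'
    X-rds = proj₁ (proj₂ (proj₂ linked))

    X⁻¹≐Xχ : ∀ α → _≐_ G (inv G (X α)) (X (χ α))
    X⁻¹≐Xχ = proj₁ (proj₂ (proj₂ (proj₂ (proj₂ linked))))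

    Xα⋆Xχα : ∀ α → _≈ᴿ_ G (_⊛_ G (ul G (X α)) (ul G (X (χ α))))
                         (_⊕_ G (_·ℤ_ G (+ (n ℕ.* λ')) (ul G (singleton G (FinGroup.e G))))
                                (_·ℤ_ G (+ λ') (ul G (_∖ˢ_ G (whole G) N))))
    Xα⋆Xχα = proj₁ (proj₂ (proj₂ (proj₂ (proj₂ (proj₂ linked)))))

    Xα⋆Xβ : ∀ α β (β≢χα : β ≢ χ α) →
            _≈ᴿ_ G (_⊛_ G (ul G (X α)) (ul G (X β)))
                   (_⊕_ G (_·ℤ_ G (+ μ) (ul G (X (ψ α β β≢χα))))
                          (_·ℤ_ G (+ ν) (ul G (_∖ˢ_ G (whole G) (X (ψ α β β≢χα))))))
    Xα⋆Xβ = proj₂ (proj₂ (proj₂ (proj₂ (proj₂ (proj₂ linked)))))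

    distinct-pair : ∀ (xs : List W) → Unique xs → length xs ≡ w → Σ W λ a → Σ W λ b → a ≢ b
    distinct-pair (a ∷ b ∷ _) ((a≢b All.∷ _) ∷ _) _ = a , b , a≢b
    distinct-pair []          _ refl with 2≤w
    ... | ()
    distinct-pair (_ ∷ [])    _ refl with 2≤w
    ... | ℕ.s≤s ()

    α₀ : W
    α₀ = proj₁ (distinct-pair Welems W-unique ∣W∣≡w)

    avoid : ∀ c → Σ W λ β → β ≢ c
    avoid c with distinct-pair Welems W-unique ∣W∣≡w
    ... | a , b , a≢b with a ≟W c
    ...   | no a≢c  = a , a≢c
    ...   | yes a≡c = b , λ b≡c → a≢b (trans a≡c (sym b≡c))

    β₀ : W
    β₀ = proj₁ (avoid (χ α₀))

    β₀≢χα₀ : β₀ ≢ χ α₀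
    β₀≢χα₀ = proj₂ (avoid (χ α₀))

    module Φ = AssociatedGroupIso U _≟W_ χ ψ φ φ-bijective φ-hom
    open Layers G U w (Φ.∣U∣≡ W-complete W-unique ∣W∣≡w) public

    module F5 = Kronecker {Fin 5} Fin._≟_

    module R = SemiregularRDS G N (proj₁ (X-rds α₀)) n λ'
                               (proj₁ (proj₂ (X-rds α₀))) (proj₁ (proj₂ (proj₂ (X-rds α₀))))

    X-meetsRight : ∀ α → R.MeetsRightCosetsAtMostOnce (X α)
    X-meetsRight α = R.rds⇒meetsRightCosetsAtMostOnce (X α) (n ℕ.* λ') (proj₂ (proj₂ (proj₂ (proj₂ (X-rds α)))))

    module Xᵗ (α : W) = R.Transversal (X α) (proj₁ (proj₂ (proj₂ (proj₂ (X-rds α)))))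
      (X-meetsRight α) (R.meetsRight⁻¹⇒meetsLeft (X α) (X (χ α)) (X⁻¹≐Xχ α) (X-meetsRight (χ α)))

    X̂ : Maybe W → Sub G
    X̂ nothing  _ = false
    X̂ (just α)   = X α

    Xφ : U.Carrier → ℤ[H] G
    Xφ u a = ⟦ X̂ (φ u) a ⟧

    nλ ∣G∣ : ℤ
    nλ  = + (n ℕ.* λ')
    ∣G∣ = + (n ℕ.* λ' ℕ.* n)

    ∑Xφ : ∀ {u} → u ≢ U.e → G.∑ (Xφ u) ≡ nλ
    ∑Xφ u≢e with Φ.φ-≢ε u≢e
    ... | α , φu≡α rewrite φu≡α = Xᵗ.∑𝟙Y α

    E N₀ G₀ X* G* : ℤ[H] H
    E  = H.δ H.e
    N₀ = layered δ₀ (const R.𝟙N)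
    G₀ = layered δ₀ (const G.𝟙)
    X* = layered δ* Xφ
    G* = layered δ* (const G.𝟙)

    E-layered : ∀ g z → E (g , z) ≡ δ₀ z * G.δ G.e g
    E-layered g z with H.δ-cases H.e (g , z) | G.δ-cases G.e g
    ... | inj₁ (refl , E≡1)   | _                 = trans E≡1 (sym (cong₂ _*_ (U.δ-refl U.e) (G.δ-refl G.e)))
    ... | inj₂ (_ , E≡0)      | inj₂ (_ , δeg≡0)  =
      trans E≡0 (sym (trans (cong (δ₀ z *_) δeg≡0) (ℤₚ.*-zeroʳ (δ₀ z))))
    ... | inj₂ (gz≢e , E≡0)   | inj₁ (refl , δeg≡1)
      rewrite δeg≡1 | U.δ-≢ (λ z≡e → gz≢e (cong (G.e ,_) z≡e)) = E≡0

    private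
      scale : ∀ a c → a * c ≡ c * (a * + 1)
      scale a c = trans (ℤₚ.*-comm a c) (cong (c *_) (sym (ℤₚ.*-identityʳ a)))

      swap : ∀ a b c → a * (b * c) ≡ b * (a * c)
      swap = x∙yz≈y∙xz
        where open CommSemigroupProperties ℤₚ.*-commutativeSemigroup using (x∙yz≈y∙xz)

      -- w C on the layer G × {e} and (w - 1) C off it
      split : ∀ d c → (+ w - (+ 1 - d)) * c ≡ (+ w * c) * (d * + 1) + ((+ w - + 1) * c) * ((+ 1 - d) * + 1)
      split = identity (+ w)
        where identity : ∀ v d c → (v - (+ 1 - d)) * c ≡ (v * c) * (d * + 1) + ((v - + 1) * c) * ((+ 1 - d) * + 1)
              identity = solve-∀

    N₀⋆N₀ : ∀ g z → (N₀ H.⋆ N₀) (g , z) ≡ + n * N₀ (g , z)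
    N₀⋆N₀ g z = trans (layered-⋆ δ₀ δ₀ (const R.𝟙N) (const R.𝟙N) g z) (trans (∑-δ₀-· δ₀ _ z)
                  (trans (cong (δ₀ z *_) (R.𝟙N⋆𝟙N g)) (swap (δ₀ z) (+ n) (R.𝟙N g))))

    N₀⋆G₀ : ∀ g z → (N₀ H.⋆ G₀) (g , z) ≡ + n * G₀ (g , z)
    N₀⋆G₀ g z = trans (layered-⋆ δ₀ δ₀ (const R.𝟙N) (const G.𝟙) g z) (trans (∑-δ₀-· δ₀ _ z)
                  (trans (cong (δ₀ z *_) (trans (G.⋆𝟙 R.𝟙N g) R.∑𝟙N)) (scale (δ₀ z) (+ n))))

    N₀⋆X* : ∀ g z → (N₀ H.⋆ X*) (g , z) ≡ G* (g , z)
    N₀⋆X* g z = trans (layered-⋆ δ₀ δ* (const R.𝟙N) Xφ g z) (trans (∑-δ₀-· δ* _ z) (δ*-*-cong z =1))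
      where
      =1 : z ≢ U.e → (R.𝟙N G.⋆ Xφ (U.e U.\\ z)) g ≡ + 1
      =1 z≢e rewrite U.ε\\x≡x z with Φ.φ-≢ε z≢e
      ... | α , φz≡α rewrite φz≡α = Xᵗ.𝟙N⋆𝟙Y α g

    N₀⋆G* : ∀ g z → (N₀ H.⋆ G*) (g , z) ≡ + n * G* (g , z)
    N₀⋆G* g z = trans (layered-⋆ δ₀ δ* (const R.𝟙N) (const G.𝟙) g z) (trans (∑-δ₀-· δ* _ z)
                  (trans (cong (δ* z *_) (trans (G.⋆𝟙 R.𝟙N g) R.∑𝟙N)) (scale (δ* z) (+ n))))

    G₀⋆N₀ : ∀ g z → (G₀ H.⋆ N₀) (g , z) ≡ + n * G₀ (g , z)
    G₀⋆N₀ g z = trans (layered-⋆ δ₀ δ₀ (const G.𝟙) (const R.𝟙N) g z) (trans (∑-δ₀-· δ₀ _ z)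
                  (trans (cong (δ₀ z *_) (trans (G.𝟙⋆ R.𝟙N g) R.∑𝟙N)) (scale (δ₀ z) (+ n))))

    G₀⋆G₀ : ∀ g z → (G₀ H.⋆ G₀) (g , z) ≡ ∣G∣ * G₀ (g , z)
    G₀⋆G₀ g z = trans (layered-⋆ δ₀ δ₀ (const G.𝟙) (const G.𝟙) g z) (trans (∑-δ₀-· δ₀ _ z)
                  (trans (cong (δ₀ z *_) (trans (G.𝟙⋆ G.𝟙 g) R.∑𝟙)) (scale (δ₀ z) ∣G∣)))

    G₀⋆X* : ∀ g z → (G₀ H.⋆ X*) (g , z) ≡ nλ * G* (g , z)
    G₀⋆X* g z = trans (layered-⋆ δ₀ δ* (const G.𝟙) Xφ g z) (trans (∑-δ₀-· δ* _ z)
                  (trans (δ*-*-cong z =nλ) (scale (δ* z) nλ)))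
      where
      =nλ : z ≢ U.e → (G.𝟙 G.⋆ Xφ (U.e U.\\ z)) g ≡ nλ
      =nλ z≢e rewrite U.ε\\x≡x z = trans (G.𝟙⋆ (Xφ z) g) (∑Xφ z≢e)

    G₀⋆G* : ∀ g z → (G₀ H.⋆ G*) (g , z) ≡ ∣G∣ * G* (g , z)
    G₀⋆G* g z = trans (layered-⋆ δ₀ δ* (const G.𝟙) (const G.𝟙) g z) (trans (∑-δ₀-· δ* _ z)
                  (trans (cong (δ* z *_) (trans (G.𝟙⋆ G.𝟙 g) R.∑𝟙)) (scale (δ* z) ∣G∣)))

    X*⋆N₀ : ∀ g z → (X* H.⋆ N₀) (g , z) ≡ G* (g , z)
    X*⋆N₀ g z = trans (layered-⋆ δ* δ₀ Xφ (const R.𝟙N) g z) (trans (∑-·-δ₀ δ* _ z) (δ*-*-cong z =1))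
      where
      =1 : z ≢ U.e → (Xφ z G.⋆ R.𝟙N) g ≡ + 1
      =1 z≢e with Φ.φ-≢ε z≢e
      ... | α , φz≡α rewrite φz≡α = Xᵗ.𝟙Y⋆𝟙N α g

    X*⋆G₀ : ∀ g z → (X* H.⋆ G₀) (g , z) ≡ nλ * G* (g , z)
    X*⋆G₀ g z = trans (layered-⋆ δ* δ₀ Xφ (const G.𝟙) g z) (trans (∑-·-δ₀ δ* _ z)
                  (trans (δ*-*-cong z (λ z≢e → trans (G.⋆𝟙 (Xφ z) g) (∑Xφ z≢e))) (scale (δ* z) nλ)))

    X*⋆G* : ∀ g z → (X* H.⋆ G*) (g , z) ≡ (+ w * nλ) * G₀ (g , z) + ((+ w - + 1) * nλ) * G* (g , z)
    X*⋆G* g z = trans (layered-⋆ δ* δ* Xφ (const G.𝟙) g z) (trans (∑-δ*-δ* _ z nλ =nλ) (split (δ₀ z) nλ))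
      where
      =nλ : ∀ u → u ≢ U.e → u ≢ z → (Xφ u G.⋆ G.𝟙) g ≡ nλ
      =nλ u u≢e _ = trans (G.⋆𝟙 (Xφ u) g) (∑Xφ u≢e)

    G*⋆N₀ : ∀ g z → (G* H.⋆ N₀) (g , z) ≡ + n * G* (g , z)
    G*⋆N₀ g z = trans (layered-⋆ δ* δ₀ (const G.𝟙) (const R.𝟙N) g z) (trans (∑-·-δ₀ δ* _ z)
                  (trans (cong (δ* z *_) (trans (G.𝟙⋆ R.𝟙N g) R.∑𝟙N)) (scale (δ* z) (+ n))))

    G*⋆G₀ : ∀ g z → (G* H.⋆ G₀) (g , z) ≡ ∣G∣ * G* (g , z)
    G*⋆G₀ g z = trans (layered-⋆ δ* δ₀ (const G.𝟙) (const G.𝟙) g z) (trans (∑-·-δ₀ δ* _ z)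
                  (trans (cong (δ* z *_) (trans (G.𝟙⋆ G.𝟙 g) R.∑𝟙)) (scale (δ* z) ∣G∣)))

    G*⋆X* : ∀ g z → (G* H.⋆ X*) (g , z) ≡ (+ w * nλ) * G₀ (g , z) + ((+ w - + 1) * nλ) * G* (g , z)
    G*⋆X* g z = trans (layered-⋆ δ* δ* (const G.𝟙) Xφ g z) (trans (∑-δ*-δ* _ z nλ =nλ) (split (δ₀ z) nλ))
      where
      =nλ : ∀ u → u ≢ U.e → u ≢ z → (G.𝟙 G.⋆ Xφ (u U.\\ z)) g ≡ nλ
      =nλ u _ u≢z = trans (G.𝟙⋆ _ g) (∑Xφ (u≢z ∘ U.x\\y≡ε⇒x≡y u z))

    G*⋆G* : ∀ g z → (G* H.⋆ G*) (g , z) ≡ (+ w * ∣G∣) * G₀ (g , z) + ((+ w - + 1) * ∣G∣) * G* (g , z)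
    G*⋆G* g z = trans (layered-⋆ δ* δ* (const G.𝟙) (const G.𝟙) g z)
                  (trans (∑-δ*-δ* _ z ∣G∣ (λ _ _ _ → trans (G.𝟙⋆ G.𝟙 g) R.∑𝟙)) (split (δ₀ z) ∣G∣))

    X*⋆X*-layer₀ : ∀ g → (X* H.⋆ X*) (g , U.e) ≡ + w * (nλ * G.δ G.e g + + λ' * ⟦ not (N g) ⟧)
    X*⋆X*-layer₀ g = trans (layered-⋆ δ* δ* Xφ Xφ g U.e)
      (trans (∑-δ*-δ* _ U.e C =C)
             (cong (_* C) (trans (cong (λ d → + w - (+ 1 - d)) (U.δ-refl U.e)) (ℤₚ.+-identityʳ (+ w)))))
      where
      C = nλ * G.δ G.e g + + λ' * ⟦ not (N g) ⟧
      =C : ∀ u → u ≢ U.e → u ≢ U.e → (Xφ u G.⋆ Xφ (u U.\\ U.e)) g ≡ C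
      =C u u≢e _ rewrite U.identityʳ (u U.⁻¹) with Φ.φ-≢ε u≢e
      ... | α , φu≡α rewrite φu≡α | Φ.φ-⁻¹ φu≡α = Xα⋆Xχα α g

    X*⋆X*-layer* : ∀ g {z γ} → φ z ≡ just γ →
                   (X* H.⋆ X*) (g , z) ≡ (+ w - + 1) * (+ μ * ⟦ X γ g ⟧ + + ν * ⟦ not (X γ g) ⟧)
    X*⋆X*-layer* g {z} {γ} φz≡γ = trans (layered-⋆ δ* δ* Xφ Xφ g z)
      (trans (∑-δ*-δ* _ z C =C) (cong (λ d → (+ w - (+ 1 - d)) * C) (U.δ-≢ (Φ.φ-just⇒≢ε φz≡γ))))
      where
      C = + μ * ⟦ X γ g ⟧ + + ν * ⟦ not (X γ g) ⟧
      =C : ∀ u → u ≢ U.e → u ≢ z → (Xφ u G.⋆ Xφ (u U.\\ z)) g ≡ C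
      =C u u≢e u≢z with Φ.φ-≢ε u≢e | Φ.φ-≢ε (u≢z ∘ U.x\\y≡ε⇒x≡y u z)
      ... | α , φu≡α | β , φu\\z≡β with Φ.φ-∙ φu≡α φu\\z≡β (trans (cong φ (U.\\-leftDividesˡ u z)) φz≡γ)
      ...   | β≢χα , ψαβ≡γ rewrite φu≡α | φu\\z≡β | sym ψαβ≡γ = Xα⋆Xβ α β β≢χα g

    X*⋆X* : ∀ x → (X* H.⋆ X*) x ≡ (+ w * nλ) * E x + (+ w * + λ') * (G₀ x - N₀ x)
                                   + ((+ w - + 1) * + μ) * X* x + ((+ w - + 1) * + ν) * (G* x - X* x)
    X*⋆X* (g , z) with U.δ-cases U.e z
    ... | inj₁ (refl , δ₀z≡1) rewrite X*⋆X*-layer₀ g | E-layered g U.e | δ₀z≡1 | ⟦⟧-not (N g) =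
      layer₀ (+ w) nλ (+ λ') (G.δ G.e g) (R.𝟙N g) (Xφ U.e g) (+ μ) (+ ν)
      where layer₀ : ∀ v a l d b x m k → v * (a * d + l * (+ 1 - b))
                     ≡ (v * a) * (+ 1 * d) + (v * l) * (+ 1 * + 1 - + 1 * b)
                       + ((v - + 1) * m) * ((+ 1 - + 1) * x) + ((v - + 1) * k) * ((+ 1 - + 1) * + 1 - (+ 1 - + 1) * x)
            layer₀ = solve-∀
    ... | inj₂ (z≢e , δ₀z≡0) with Φ.φ-≢ε z≢e
    ...   | γ , φz≡γ rewrite X*⋆X*-layer* g φz≡γ | E-layered g z | δ₀z≡0 | φz≡γ | ⟦⟧-not (X γ g) =
      layer* (+ w) nλ (+ λ') (G.δ G.e g) (R.𝟙N g) ⟦ X γ g ⟧ (+ μ) (+ ν)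
      where layer* : ∀ v a l d b x m k → (v - + 1) * (m * x + k * (+ 1 - x))
                     ≡ (v * a) * (+ 0 * d) + (v * l) * (+ 0 * + 1 - + 0 * b)
                       + ((v - + 1) * m) * ((+ 1 - + 0) * x) + ((v - + 1) * k) * ((+ 1 - + 0) * + 1 - (+ 1 - + 0) * x)
            layer* = solve-∀

    T : Fin 5 → Sub H
    T = Tset G U φ N X

    𝟙T : Fin 5 → ℤ[H] H
    𝟙T i = ul H (T i)

    private
      ⟦b∧¬c∧d⟧ : ∀ b c d → (c ≡ true → b ≡ true) → ⟦ b ∧ not c ∧ d ⟧ ≡ ⟦ d ⟧ * ⟦ b ⟧ - ⟦ d ⟧ * ⟦ c ⟧
      ⟦b∧¬c∧d⟧ true  true  true  _ = refl
      ⟦b∧¬c∧d⟧ true  true  false _ = refl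
      ⟦b∧¬c∧d⟧ true  false true  _ = refl
      ⟦b∧¬c∧d⟧ true  false false _ = refl
      ⟦b∧¬c∧d⟧ false true  _     c⇒b with c⇒b refl
      ... | ()
      ⟦b∧¬c∧d⟧ false false true  _ = refl
      ⟦b∧¬c∧d⟧ false false false _ = refl

      ⟦¬b∧d⟧ : ∀ b d → ⟦ not b ∧ d ⟧ ≡ ⟦ d ⟧ * + 1 - ⟦ d ⟧ * ⟦ b ⟧
      ⟦¬b∧d⟧ true  true  = refl
      ⟦¬b∧d⟧ true  false = refl
      ⟦¬b∧d⟧ false true  = refl
      ⟦¬b∧d⟧ false false = refl

      ⟦¬d∧b⟧ : ∀ d b → ⟦ not d ∧ b ⟧ ≡ (+ 1 - ⟦ d ⟧) * ⟦ b ⟧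
      ⟦¬d∧b⟧ true  true  = refl
      ⟦¬d∧b⟧ true  false = refl
      ⟦¬d∧b⟧ false true  = refl
      ⟦¬d∧b⟧ false false = refl

      ⟦¬d∧¬b⟧ : ∀ d b → ⟦ not d ∧ not b ⟧ ≡ (+ 1 - ⟦ d ⟧) * + 1 - (+ 1 - ⟦ d ⟧) * ⟦ b ⟧
      ⟦¬d∧¬b⟧ true  true  = refl
      ⟦¬d∧¬b⟧ true  false = refl
      ⟦¬d∧¬b⟧ false true  = refl
      ⟦¬d∧¬b⟧ false false = refl

    ⌊≟ε⌋⇒N : ∀ g → ⌊ g G.≟ G.e ⌋ ≡ true → N g ≡ true
    ⌊≟ε⌋⇒N g g≟e rewrite ⌊≟⌋-true⁻ G._≟_ g≟e = R.N-ε

    φ-∞⇒⌊≟ε⌋ : ∀ z → φ z ≡ nothing → ⌊ z U.≟ U.e ⌋ ≡ true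
    φ-∞⇒⌊≟ε⌋ z φz≡∞ rewrite Φ.φ-∞⇒ε φz≡∞ = ⌊≟⌋-refl U._≟_ U.e

    𝟙T₀ : ∀ x → 𝟙T 0F x ≡ E x
    𝟙T₀ (g , z) = trans (sym (⟦⟧-∧ ⌊ g G.≟ G.e ⌋ ⌊ z U.≟ U.e ⌋))
                        (trans (ℤₚ.*-comm ⟦ ⌊ g G.≟ G.e ⌋ ⟧ _) (sym (E-layered g z)))

    𝟙T₁ : ∀ x → 𝟙T 1F x ≡ N₀ x - E x
    𝟙T₁ (g , z) = trans (⟦b∧¬c∧d⟧ (N g) ⌊ g G.≟ G.e ⌋ ⌊ z U.≟ U.e ⌋ (⌊≟ε⌋⇒N g))
                        (cong (_-_ (N₀ (g , z))) (sym (E-layered g z)))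

    𝟙T₂ : ∀ x → 𝟙T 2F x ≡ G₀ x - N₀ x
    𝟙T₂ (g , z) = ⟦¬b∧d⟧ (N g) ⌊ z U.≟ U.e ⌋

    𝟙T₃ : ∀ x → 𝟙T 3F x ≡ X* x
    𝟙T₃ (g , z) with φ z
    ... | nothing = sym (ℤₚ.*-zeroʳ (δ* z))
    ... | just α  = ⟦¬d∧b⟧ ⌊ z U.≟ U.e ⌋ (X α g)

    𝟙T₄ : ∀ x → 𝟙T 4F x ≡ G* x - X* x
    𝟙T₄ (g , z) with φ z in φz
    ... | nothing rewrite φ-∞⇒⌊≟ε⌋ z φz = refl
    ... | just α  = ⟦¬d∧¬b⟧ ⌊ z U.≟ U.e ⌋ (X α g)

    Spanned : ℤ[H] H → Set
    Spanned = InSpan H T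

    spanned-≗ : ∀ {f g : ℤ[H] H} → (∀ x → f x ≡ g x) → Spanned g → Spanned f
    spanned-≗ f≗g (c , g≈c) = c , λ x → trans (f≗g x) (g≈c x)

    spanned-+ : ∀ {f g : ℤ[H] H} → Spanned f → Spanned g → Spanned (λ x → f x + g x)
    spanned-+ (c , f≈c) (d , g≈d) = (λ i → c i + d i) , λ x → trans (cong₂ _+_ (f≈c x) (g≈d x))
      (sym (trans (sumℤ-cong (allFinL 5) (λ i → ℤₚ.*-distribʳ-+ (𝟙T i x) (c i) (d i)))
                  (sumℤ-+ (allFinL 5) (λ i → c i * 𝟙T i x) (λ i → d i * 𝟙T i x))))

    spanned-* : ∀ {f : ℤ[H] H} k → Spanned f → Spanned (λ x → k * f x)
    spanned-* k (c , f≈c) = (λ i → k * c i) , λ x → trans (cong (k *_) (f≈c x))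
      (sym (trans (sumℤ-cong (allFinL 5) (λ i → ℤₚ.*-assoc k (c i) (𝟙T i x)))
                  (sumℤ-*ˡ (allFinL 5) k (λ i → c i * 𝟙T i x))))

    spanned-sum : ∀ {I : Set} (is : List I) (F : I → ℤ[H] H) → (∀ i → Spanned (F i)) →
                  Spanned (λ x → sumℤ (λ i → F i x) is)
    spanned-sum []       F F∈ = (λ _ → + 0) , λ x → sym (sumℤ-zero (allFinL 5))
    spanned-sum (i ∷ is) F F∈ = spanned-+ (F∈ i) (spanned-sum is F F∈)

    spanned-𝟙T : ∀ i → Spanned (𝟙T i)
    spanned-𝟙T i = (λ j → F5.δ i j) , λ x →
      sym (F5.sumℤ-δ (allFinL-unique 5) (∈-allFinL i) (λ j → 𝟙T j x))

    B : Fin 5 → ℤ[H] H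
    B 0F = E
    B 1F = N₀
    B 2F = G₀
    B 3F = X*
    B 4F = G*

    spanned-by-difference : ∀ i {f g} → (∀ x → 𝟙T i x ≡ f x - g x) → Spanned g → Spanned f
    spanned-by-difference i {f} {g} 𝟙Tᵢ≗f-g g∈ =
      spanned-≗ (λ x → trans (sym (ℤ+.//-rightDividesˡ (g x) (f x))) (cong (_+ g x) (sym (𝟙Tᵢ≗f-g x))))
                (spanned-+ (spanned-𝟙T i) g∈)

    spanned-E : Spanned E
    spanned-E = spanned-≗ (sym ∘ 𝟙T₀) (spanned-𝟙T 0F)

    spanned-N₀ : Spanned N₀
    spanned-N₀ = spanned-by-difference 1F 𝟙T₁ spanned-E

    spanned-G₀ : Spanned G₀
    spanned-G₀ = spanned-by-difference 2F 𝟙T₂ spanned-N₀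

    spanned-X* : Spanned X*
    spanned-X* = spanned-≗ (sym ∘ 𝟙T₃) (spanned-𝟙T 3F)

    spanned-G* : Spanned G*
    spanned-G* = spanned-by-difference 4F 𝟙T₄ spanned-X*

    spanned-B : ∀ k → Spanned (B k)
    spanned-B 0F = spanned-E
    spanned-B 1F = spanned-N₀
    spanned-B 2F = spanned-G₀
    spanned-B 3F = spanned-X*
    spanned-B 4F = spanned-G*

    spanned-B⋆B : ∀ k l → Spanned (B k H.⋆ B l)
    spanned-B⋆B 0F l  = spanned-≗ (H.⋆-identityˡ (B l)) (spanned-B l)
    spanned-B⋆B 1F 0F = spanned-≗ (H.⋆-identityʳ N₀) (spanned-B 1F)
    spanned-B⋆B 2F 0F = spanned-≗ (H.⋆-identityʳ G₀) (spanned-B 2F)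
    spanned-B⋆B 3F 0F = spanned-≗ (H.⋆-identityʳ X*) (spanned-B 3F)
    spanned-B⋆B 4F 0F = spanned-≗ (H.⋆-identityʳ G*) (spanned-B 4F)
    spanned-B⋆B 1F 1F = spanned-≗ (λ (g , z) → N₀⋆N₀ g z) (spanned-* (+ n) (spanned-B 1F))
    spanned-B⋆B 1F 2F = spanned-≗ (λ (g , z) → N₀⋆G₀ g z) (spanned-* (+ n) (spanned-B 2F))
    spanned-B⋆B 1F 3F = spanned-≗ (λ (g , z) → N₀⋆X* g z) (spanned-B 4F)
    spanned-B⋆B 1F 4F = spanned-≗ (λ (g , z) → N₀⋆G* g z) (spanned-* (+ n) (spanned-B 4F))
    spanned-B⋆B 2F 1F = spanned-≗ (λ (g , z) → G₀⋆N₀ g z) (spanned-* (+ n) (spanned-B 2F))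
    spanned-B⋆B 2F 2F = spanned-≗ (λ (g , z) → G₀⋆G₀ g z) (spanned-* ∣G∣ (spanned-B 2F))
    spanned-B⋆B 2F 3F = spanned-≗ (λ (g , z) → G₀⋆X* g z) (spanned-* nλ (spanned-B 4F))
    spanned-B⋆B 2F 4F = spanned-≗ (λ (g , z) → G₀⋆G* g z) (spanned-* ∣G∣ (spanned-B 4F))
    spanned-B⋆B 3F 1F = spanned-≗ (λ (g , z) → X*⋆N₀ g z) (spanned-B 4F)
    spanned-B⋆B 3F 2F = spanned-≗ (λ (g , z) → X*⋆G₀ g z) (spanned-* nλ (spanned-B 4F))
    spanned-B⋆B 3F 3F = spanned-≗ X*⋆X*
      (spanned-+ (spanned-+ (spanned-+ (spanned-* (+ w * nλ) (spanned-B 0F))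
                                       (spanned-* (+ w * + λ') (spanned-≗ (sym ∘ 𝟙T₂) (spanned-𝟙T 2F))))
                            (spanned-* ((+ w - + 1) * + μ) (spanned-B 3F)))
                 (spanned-* ((+ w - + 1) * + ν) (spanned-≗ (sym ∘ 𝟙T₄) (spanned-𝟙T 4F))))
    spanned-B⋆B 3F 4F = spanned-≗ (λ (g , z) → X*⋆G* g z)
      (spanned-+ (spanned-* (+ w * nλ) (spanned-B 2F)) (spanned-* ((+ w - + 1) * nλ) (spanned-B 4F)))
    spanned-B⋆B 4F 1F = spanned-≗ (λ (g , z) → G*⋆N₀ g z) (spanned-* (+ n) (spanned-B 4F))
    spanned-B⋆B 4F 2F = spanned-≗ (λ (g , z) → G*⋆G₀ g z) (spanned-* ∣G∣ (spanned-B 4F))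
    spanned-B⋆B 4F 3F = spanned-≗ (λ (g , z) → G*⋆X* g z)
      (spanned-+ (spanned-* (+ w * nλ) (spanned-B 2F)) (spanned-* ((+ w - + 1) * nλ) (spanned-B 4F)))
    spanned-B⋆B 4F 4F = spanned-≗ (λ (g , z) → G*⋆G* g z)
      (spanned-+ (spanned-* (+ w * ∣G∣) (spanned-B 2F)) (spanned-* ((+ w - + 1) * ∣G∣) (spanned-B 4F)))

    𝟙T-in-B : Fin 5 → Fin 5 → ℤ
    𝟙T-in-B 0F = F5.δ 0F
    𝟙T-in-B 1F = λ { 0F → - + 1 ; 1F → + 1 ; _ → + 0 }
    𝟙T-in-B 2F = λ { 1F → - + 1 ; 2F → + 1 ; _ → + 0 }
    𝟙T-in-B 3F = F5.δ 3F
    𝟙T-in-B 4F = λ { 3F → - + 1 ; 4F → + 1 ; _ → + 0 }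

    𝟙T≡∑B : ∀ i x → 𝟙T i x ≡ sumℤ (λ k → 𝟙T-in-B i k * B k x) (allFinL 5)
    𝟙T≡∑B 0F x = trans (𝟙T₀ x) (sym (F5.sumℤ-δ (allFinL-unique 5) (∈-allFinL 0F) (λ k → B k x)))
    𝟙T≡∑B 3F x = trans (𝟙T₃ x) (sym (F5.sumℤ-δ (allFinL-unique 5) (∈-allFinL 3F) (λ k → B k x)))
    𝟙T≡∑B 1F x = trans (𝟙T₁ x) (difference (B 0F x) (B 1F x) (B 2F x) (B 3F x) (B 4F x))
      where difference : ∀ a b c d f → b - a ≡ - + 1 * a + (+ 1 * b + (+ 0 * c + (+ 0 * d + (+ 0 * f + + 0))))
            difference = solve-∀
    𝟙T≡∑B 2F x = trans (𝟙T₂ x) (difference (B 0F x) (B 1F x) (B 2F x) (B 3F x) (B 4F x))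
      where difference : ∀ a b c d f → c - b ≡ + 0 * a + (- + 1 * b + (+ 1 * c + (+ 0 * d + (+ 0 * f + + 0))))
            difference = solve-∀
    𝟙T≡∑B 4F x = trans (𝟙T₄ x) (difference (B 0F x) (B 1F x) (B 2F x) (B 3F x) (B 4F x))
      where difference : ∀ a b c d f → f - d ≡ + 0 * a + (+ 0 * b + (+ 0 * c + (- + 1 * d + (+ 1 * f + + 0))))
            difference = solve-∀

    spanned-𝟙T⋆𝟙T : ∀ i j → Spanned (𝟙T i H.⋆ 𝟙T j)
    spanned-𝟙T⋆𝟙T i j =
      spanned-≗ (λ x → trans (H.⋆-cong (𝟙T≡∑B i) (𝟙T≡∑B j) x)
                             (H.⋆-bilinear (allFinL 5) (𝟙T-in-B i) (𝟙T-in-B j) B x))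
                (spanned-sum (allFinL 5) _ λ k → spanned-sum (allFinL 5) _ λ l →
                   spanned-* (𝟙T-in-B i k * 𝟙T-in-B j l) (spanned-B⋆B k l))

    1≤n : 1 ℕ.≤ n
    1≤n = ℕₚ.≤-trans (ℕ.s≤s ℕ.z≤n) 2≤n

    ∣G∣-nλ≡nλ[n-1] : ∣G∣ - nλ ≡ nλ * (+ n - + 1)
    ∣G∣-nλ≡nλ[n-1] = begin
      + (n ℕ.* λ' ℕ.* n) - nλ   ≡⟨ cong (_- nλ) (ℤₚ.pos-* (n ℕ.* λ') n) ⟩
      nλ * + n - nλ
        ≡⟨ cong (_+_ (nλ * + n)) (trans (cong -_ (sym (ℤₚ.*-identityʳ nλ))) (ℤₚ.neg-distribʳ-* nλ (+ 1))) ⟩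
      nλ * + n + nλ * - + 1     ≡⟨ ℤₚ.*-distribˡ-+ nλ (+ n) (- + 1) ⟨
      nλ * (+ n - + 1)          ∎
      where open ≡-Reasoning

    λ'≢0 : λ' ≢ 0
    λ'≢0 refl = ∣G∣≢0 (trans (proj₁ (proj₂ (X-rds α₀))) (cong (ℕ._* n) (ℕₚ.*-zeroʳ n)))
      where
      ∣G∣≢0 : ∣H∣ G ≢ 0
      ∣G∣≢0 with G.elems | G.complete G.e
      ... | _ ∷ _ | _ = λ ()

    nλ≢0 : n ℕ.* λ' ≢ 0
    nλ≢0 nλ≡0 with ℕₚ.m*n≡0⇒m≡0∨n≡0 n nλ≡0
    ... | inj₁ refl = ℕₚ.<⇒≢ 1≤n refl
    ... | inj₂ λ'≡0 = λ'≢0 λ'≡0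

    n<∣G∣ : n ℕ.< n ℕ.* λ' ℕ.* n
    n<∣G∣ = ℕₚ.<-≤-trans (ℕₚ.m<m*n n n {{ℕ.>-nonZero 1≤n}} 2≤n)
                         (ℕₚ.*-monoˡ-≤ n (ℕₚ.m≤m*n n λ' {{ℕ.≢-nonZero λ'≢0}}))

    l₀,N-l₀,l₀≢ε : Σ G.Carrier λ l → N l ≡ true × l ≢ G.e
    l₀,N-l₀,l₀≢ε = G.∃-≢ N G.e (subst (+ 1 ℤ.<_) (sym R.∑𝟙N) (ℤ.+<+ 2≤n))

    l₀ : G.Carrier
    l₀ = proj₁ l₀,N-l₀,l₀≢ε

    N-l₀ : N l₀ ≡ true
    N-l₀ = proj₁ (proj₂ l₀,N-l₀,l₀≢ε)

    l₀≢ε : l₀ ≢ G.e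
    l₀≢ε = proj₂ (proj₂ l₀,N-l₀,l₀≢ε)

    g₂,N-g₂ : Σ G.Carrier λ g → N g ≡ false
    g₂,N-g₂ = G.∃-false N
      (λ ∑N≡∑𝟙 → ℕₚ.<⇒≢ n<∣G∣ (ℤₚ.+-injective (trans (sym R.∑𝟙N) (trans ∑N≡∑𝟙 R.∑𝟙))))

    g₂ : G.Carrier
    g₂ = proj₁ g₂,N-g₂

    N-g₂ : N g₂ ≡ false
    N-g₂ = proj₂ g₂,N-g₂

    z₃ : U.Carrier
    z₃ = proj₁ (Φ.φ-surjective (just α₀))

    φ-z₃ : φ z₃ ≡ just α₀
    φ-z₃ = proj₂ (Φ.φ-surjective (just α₀))

    z₃≢ε : z₃ ≢ U.e
    z₃≢ε = Φ.φ-just⇒≢ε φ-z₃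

    g₃ : G.Carrier
    g₃ = G.e G.// proj₁ (Xᵗ.meets-every-coset α₀ G.e)

    X-g₃ : X α₀ g₃ ≡ true
    X-g₃ = proj₂ (proj₂ (Xᵗ.meets-every-coset α₀ G.e))

    g₄ : G.Carrier
    g₄ = G.e G.// proj₁ (Xᵗ.misses-every-coset α₀ N-l₀ l₀≢ε G.e)

    X-g₄ : X α₀ g₄ ≡ false
    X-g₄ = proj₂ (proj₂ (Xᵗ.misses-every-coset α₀ N-l₀ l₀≢ε G.e))

    -- Augmenting X_α₀ X_β₀ = μ X_γ + ν (G ∖ X_γ) gives nλ² = μ nλ + ν (|G| - nλ).
    nλ≡μ+ν[n-1] : nλ ≡ + μ + + ν * (+ n - + 1)
    nλ≡μ+ν[n-1] = ℤₚ.*-cancelˡ-≡ nλ nλ _ {{ℕ.≢-nonZero nλ≢0}} (begin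
      nλ * nλ                                                 ≡⟨ cong₂ _*_ (Xᵗ.∑𝟙Y α₀) (Xᵗ.∑𝟙Y β₀) ⟨
      G.∑ (Xᵗ.𝟙Y α₀) * G.∑ (Xᵗ.𝟙Y β₀)                         ≡⟨ G.∑-⋆ (Xᵗ.𝟙Y α₀) (Xᵗ.𝟙Y β₀) ⟨
      G.∑ (Xᵗ.𝟙Y α₀ G.⋆ Xᵗ.𝟙Y β₀)                             ≡⟨ sumℤ-cong G.elems (Xα⋆Xβ α₀ β₀ β₀≢χα₀) ⟩
      G.∑ (λ g → + μ * ⟦ X γ g ⟧ + + ν * ⟦ not (X γ g) ⟧)     ≡⟨ sumℤ-+ G.elems _ _ ⟩
      G.∑ (λ g → + μ * ⟦ X γ g ⟧) + G.∑ (λ g → + ν * ⟦ not (X γ g) ⟧)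
        ≡⟨ cong₂ _+_ (sumℤ-*ˡ G.elems (+ μ) _) (sumℤ-*ˡ G.elems (+ ν) _) ⟩
      + μ * G.∑ (Xᵗ.𝟙Y γ) + + ν * G.∑ (λ g → ⟦ not (X γ g) ⟧) ≡⟨ cong₂ (λ a b → + μ * a + + ν * b) (Xᵗ.∑𝟙Y γ) ∑¬Xγ ⟩
      + μ * nλ + + ν * (nλ * (+ n - + 1))                      ≡⟨ regroup (+ μ) (+ ν) nλ (+ n - + 1) ⟩
      nλ * (+ μ + + ν * (+ n - + 1))                          ∎)
      where
      open ≡-Reasoning
      γ = ψ α₀ β₀ β₀≢χα₀
      ∑¬Xγ : G.∑ (λ g → ⟦ not (X γ g) ⟧) ≡ nλ * (+ n - + 1)
      ∑¬Xγ = trans (sumℤ-cong G.elems (λ g → ⟦⟧-not (X γ g)))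
               (trans (sumℤ-- G.elems G.𝟙 (Xᵗ.𝟙Y γ)) (trans (cong₂ _-_ R.∑𝟙 (Xᵗ.∑𝟙Y γ)) ∣G∣-nλ≡nλ[n-1]))
      regroup : ∀ m v a b → m * a + v * (a * b) ≡ a * (m + v * b)
      regroup = solve-∀

    ∑𝟙T≡1 : ∀ x → sumℤ (λ i → 𝟙T i x) (allFinL 5) ≡ + 1
    ∑𝟙T≡1 x@(g , z) = begin
      𝟙T 0F x + (𝟙T 1F x + (𝟙T 2F x + (𝟙T 3F x + (𝟙T 4F x + + 0))))
        ≡⟨ cong₂ _+_ (𝟙T₀ x) (cong₂ _+_ (𝟙T₁ x)
             (cong₂ _+_ (𝟙T₂ x) (cong₂ _+_ (𝟙T₃ x) (cong (_+ + 0) (𝟙T₄ x))))) ⟩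
      E x + ((N₀ x - E x) + ((G₀ x - N₀ x) + (X* x + ((G* x - X* x) + + 0))))
        ≡⟨ telescope (E x) (N₀ x) (δ₀ z) (X* x) ⟩
      + 1 ∎
      where
      open ≡-Reasoning
      telescope : ∀ a b d c → a + ((b - a) + ((d * + 1 - b) + (c + (((+ 1 - d) * + 1 - c) + + 0)))) ≡ + 1
      telescope = solve-∀

    block : ∀ x → Σ (Fin 5) λ k → T k x ≡ true × (∀ i → T i x ≡ true → i ≡ k)
    block x = proj₁ unique-k , proj₁ (proj₂ unique-k) , λ i → proj₂ (proj₂ unique-k) i (∈-allFinL i)
      where
      unique-k : Σ (Fin 5) λ k → T k x ≡ true × (∀ i → i ∈ allFinL 5 → T i x ≡ true → i ≡ k)
      unique-k = sumℤ⟦⟧≡1⇒∃! (λ i → T i x) (allFinL 5) (∑𝟙T≡1 x)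

    T₀-ε : T 0F (G.e , U.e) ≡ true
    T₀-ε = cong₂ _∧_ (⌊≟⌋-refl G._≟_ G.e) (⌊≟⌋-refl U._≟_ U.e)

    T₁-l₀ : T 1F (l₀ , U.e) ≡ true
    T₁-l₀ = cong₂ _∧_ N-l₀ (cong₂ _∧_ (cong not (⌊≟⌋-≢ G._≟_ l₀≢ε)) (⌊≟⌋-refl U._≟_ U.e))

    T₂-g₂ : T 2F (g₂ , U.e) ≡ true
    T₂-g₂ = cong₂ _∧_ (cong not N-g₂) (⌊≟⌋-refl U._≟_ U.e)

    T₃-intro : ∀ {h y α} → φ y ≡ just α → y ≢ U.e → X α h ≡ true → T 3F (h , y) ≡ true
    T₃-intro φy≡α y≢ε Xαh rewrite φy≡α | ⌊≟⌋-≢ U._≟_ y≢ε | Xαh = refl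

    T₄-intro : ∀ {h y α} → φ y ≡ just α → y ≢ U.e → X α h ≡ false → T 4F (h , y) ≡ true
    T₄-intro φy≡α y≢ε ¬Xαh rewrite φy≡α | ⌊≟⌋-≢ U._≟_ y≢ε | ¬Xαh = refl

    T₃-g₃ : T 3F (g₃ , z₃) ≡ true
    T₃-g₃ = T₃-intro φ-z₃ z₃≢ε X-g₃

    T₄-g₄ : T 4F (g₄ , z₃) ≡ true
    T₄-g₄ = T₄-intro φ-z₃ z₃≢ε X-g₄

    partition : IsPartition H T
    partition = nonempty , (λ x → proj₁ (block x) , proj₁ (proj₂ (block x)))
              , (λ x i j Tᵢx Tⱼx → trans (proj₂ (proj₂ (block x)) i Tᵢx) (sym (proj₂ (proj₂ (block x)) j Tⱼx)))
      where
      nonempty : ∀ i → Σ H.Carrier λ x → T i x ≡ true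
      nonempty 0F = (G.e , U.e) , T₀-ε
      nonempty 1F = (l₀ , U.e) , T₁-l₀
      nonempty 2F = (g₂ , U.e) , T₂-g₂
      nonempty 3F = (g₃ , z₃) , T₃-g₃
      nonempty 4F = (g₄ , z₃) , T₄-g₄

    X-⁻¹ : ∀ α g → X (χ α) (g G.⁻¹) ≡ X α g
    X-⁻¹ α g = trans (sym (X⁻¹≐Xχ α (g G.⁻¹))) (cong (X α) (G.⁻¹-involutive g))

    T₃-layer₀-empty : ∀ {h y} → y ≡ U.e → T 3F (h , y) ≡ false
    T₃-layer₀-empty refl rewrite Φ.φ-ε = refl

    T₄-layer₀-empty : ∀ {h y} → y ≡ U.e → T 4F (h , y) ≡ false
    T₄-layer₀-empty refl rewrite Φ.φ-ε = refl

    symmetric : IsSymmetric H T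
    symmetric 0F (g , z) = sym (cong₂ _∧_ (G.⌊⁻¹≟ε⌋ g) (U.⌊⁻¹≟ε⌋ z))
    symmetric 1F (g , z) = sym (cong₂ _∧_ (R.N-⁻¹≡ g) (cong₂ _∧_ (cong not (G.⌊⁻¹≟ε⌋ g)) (U.⌊⁻¹≟ε⌋ z)))
    symmetric 2F (g , z) = sym (cong₂ _∧_ (cong not (R.N-⁻¹≡ g)) (U.⌊⁻¹≟ε⌋ z))
    symmetric 3F (g , z) with φ z in φz
    ... | nothing = sym (T₃-layer₀-empty (trans (cong U._⁻¹ (Φ.φ-∞⇒ε φz)) U.ε⁻¹≈ε))
    ... | just α rewrite Φ.φ-⁻¹ φz = sym (cong₂ _∧_ (cong not (U.⌊⁻¹≟ε⌋ z)) (X-⁻¹ α g))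
    symmetric 4F (g , z) with φ z in φz
    ... | nothing = sym (T₄-layer₀-empty (trans (cong U._⁻¹ (Φ.φ-∞⇒ε φz)) U.ε⁻¹≈ε))
    ... | just α rewrite Φ.φ-⁻¹ φz = sym (cong₂ _∧_ (cong not (U.⌊⁻¹≟ε⌋ z)) (cong not (X-⁻¹ α g)))

    isSRing : IsSRing H T
    isSRing = partition , (0F , λ x → ⟦⟧-injective (𝟙T₀ x)) , (λ i → i , symmetric i) , spanned-𝟙T⋆𝟙T

    K L : Sub H
    K (g , z) = ⌊ z U.≟ U.e ⌋
    L (g , z) = N g ∧ ⌊ z U.≟ U.e ⌋

    ⌊ε≟ε⌋ : ⌊ U.e U.≟ U.e ⌋ ≡ true
    ⌊ε≟ε⌋ = ⌊≟⌋-refl U._≟_ U.e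

    ⌊z₃≟ε⌋ : ⌊ z₃ U.≟ U.e ⌋ ≡ false
    ⌊z₃≟ε⌋ = ⌊≟⌋-≢ U._≟_ z₃≢ε

    L-z₃ : ∀ g → L (g , z₃) ≡ false
    L-z₃ g = trans (cong (N g ∧_) ⌊z₃≟ε⌋) (Boolₚ.∧-zeroʳ (N g))

    K≤H : IsSubgroup H K
    K≤H = ⌊ε≟ε⌋
        , (λ { (g , z) (g′ , z′) → U.⌊∙≟ε⌋ })
        , (λ { (g , z) K-gz → trans (U.⌊⁻¹≟ε⌋ z) K-gz })

    L≤H : IsSubgroup H L
    L≤H = cong₂ _∧_ R.N-ε ⌊ε≟ε⌋
        , (λ { (g , z) (g′ , z′) L-gz L-gz′ → let Ng , z≟ε = ∧-true⁻ L-gz ; Ng′ , z′≟ε = ∧-true⁻ L-gz′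
                                              in cong₂ _∧_ (R.N-∙ g g′ Ng Ng′) (U.⌊∙≟ε⌋ z≟ε z′≟ε) })
        , (λ { (g , z) L-gz → let Ng , z≟ε = ∧-true⁻ L-gz
                              in cong₂ _∧_ (trans (R.N-⁻¹≡ g) Ng) (trans (U.⌊⁻¹≟ε⌋ z) z≟ε) })

    l₀ε≢ε : (l₀ , U.e) ≢ H.e
    l₀ε≢ε = l₀≢ε ∘ cong proj₁

    K-proper : ProperNontrivial H K
    K-proper = K≤H , ((l₀ , U.e) , ⌊ε≟ε⌋ , l₀ε≢ε) , ((G.e , z₃) , ⌊z₃≟ε⌋)

    L-proper : ProperNontrivial H L
    L-proper = L≤H , ((l₀ , U.e) , cong₂ _∧_ N-l₀ ⌊ε≟ε⌋ , l₀ε≢ε) , ((G.e , z₃) , L-z₃ G.e)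

    L⊆K : _⊆ˢ_ H L K
    L⊆K (g , z) L-gz = proj₂ (∧-true⁻ {N g} L-gz)

    K∖L : Σ H.Carrier λ x → K x ≡ true × L x ≡ false
    K∖L = (g₂ , U.e) , ⌊ε≟ε⌋ , cong (_∧ K (g₂ , U.e)) N-g₂

    spanned-L : Spanned (ul H L)
    spanned-L = spanned-≗ (λ (g , z) → trans (sym (⟦⟧-∧ (N g) _)) (ℤₚ.*-comm ⟦ N g ⟧ _)) spanned-N₀

    spanned-K : Spanned (ul H K)
    spanned-K = spanned-≗ (λ (g , z) → sym (ℤₚ.*-identityʳ (δ₀ z))) spanned-G₀

    T₀⊆L : _⊆ˢ_ H (T 0F) L
    T₀⊆L (g , z) T₀-gz with ∧-true⁻ {⌊ g G.≟ G.e ⌋} T₀-gz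
    ... | g≟ε , z≟ε rewrite ⌊≟⌋-true⁻ G._≟_ g≟ε = cong₂ _∧_ R.N-ε z≟ε

    T₁⊆L : _⊆ˢ_ H (T 1F) L
    T₁⊆L (g , z) T₁-gz with ∧-true⁻ {N g} T₁-gz
    ... | Ng , ¬g≟ε∧z≟ε = cong₂ _∧_ Ng (proj₂ (∧-true⁻ {not ⌊ g G.≟ G.e ⌋} ¬g≟ε∧z≟ε))

    T₂⊆K : _⊆ˢ_ H (T 2F) K
    T₂⊆K (g , z) T₂-gz = proj₂ (∧-true⁻ {not (N g)} T₂-gz)

    count-allFinL5 : ∀ (P : Fin 5 → Bool) {b₀ b₁ b₂ b₃ b₄} →
      P 0F ≡ b₀ → P 1F ≡ b₁ → P 2F ≡ b₂ → P 3F ≡ b₃ → P 4F ≡ b₄ →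
      count P (allFinL 5) ≡ count (λ b → b) (b₀ ∷ b₁ ∷ b₂ ∷ b₃ ∷ b₄ ∷ [])
    count-allFinL5 P p₀ p₁ p₂ p₃ p₄ rewrite p₀ | p₁ | p₂ | p₃ | p₄ = refl

    rank-L : rankRestr H T L ≡ 2
    rank-L = count-allFinL5 (λ i → subsetᵇ H (T i) L)
      (H.subsetᵇ-true (T 0F) L T₀⊆L) (H.subsetᵇ-true (T 1F) L T₁⊆L)
      (H.subsetᵇ-false (T 2F) L T₂-g₂ (proj₂ (proj₂ K∖L)))
      (H.subsetᵇ-false (T 3F) L T₃-g₃ (L-z₃ g₃)) (H.subsetᵇ-false (T 4F) L T₄-g₄ (L-z₃ g₄))

    rank-K : rankRestr H T K ≡ 3
    rank-K = count-allFinL5 (λ i → subsetᵇ H (T i) K)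
      (H.subsetᵇ-true (T 0F) K (λ x → L⊆K x ∘ T₀⊆L x)) (H.subsetᵇ-true (T 1F) K (λ x → L⊆K x ∘ T₁⊆L x))
      (H.subsetᵇ-true (T 2F) K T₂⊆K)
      (H.subsetᵇ-false (T 3F) K T₃-g₃ ⌊z₃≟ε⌋) (H.subsetᵇ-false (T 4F) K T₄-g₄ ⌊z₃≟ε⌋)

    Layer₀ Layer* : Fin 5 → Set
    Layer₀ i = ∀ {h y} → T i (h , y) ≡ true → y ≡ U.e
    Layer* i = ∀ {h y} → T i (h , y) ≡ true → y ≢ U.e

    ⊆K⇒layer₀ : ∀ i → _⊆ˢ_ H (T i) K → Layer₀ i
    ⊆K⇒layer₀ i T⊆K {h} {y} T-hy = ⌊≟⌋-true⁻ U._≟_ (T⊆K (h , y) T-hy)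

    T₃-layer* : Layer* 3F
    T₃-layer* {h} {y} T₃-hy with φ y
    ... | just α = ⌊≟⌋-false⁻ U._≟_ (proj₁ (∧-true⁻ T₃-hy))

    T₄-layer* : Layer* 4F
    T₄-layer* {h} {y} T₄-hy with φ y
    ... | just α = ⌊≟⌋-false⁻ U._≟_ (proj₁ (∧-true⁻ T₄-hy))

    FillsLayers : Fin 5 → Set
    FillsLayers i = ∀ g {z} → z ≢ U.e → Σ G.Carrier λ h → T i (h , z) ≡ true × N (h G.\\ g) ≡ true

    T₃-fills : FillsLayers 3F
    T₃-fills g {z} z≢ε = coset-point (Xᵗ.meets-every-coset (proj₁ (Φ.φ-≢ε z≢ε)) g)
      where
      coset-point : (Σ G.Carrier λ l → N l ≡ true × X (proj₁ (Φ.φ-≢ε z≢ε)) (g G.// l) ≡ true) →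
                    Σ G.Carrier λ h → T 3F (h , z) ≡ true × N (h G.\\ g) ≡ true
      coset-point (l , Nl , X-g//l) =
        g G.// l , T₃-intro (proj₂ (Φ.φ-≢ε z≢ε)) z≢ε X-g//l , subst (λ y → N y ≡ true) (sym (G.[x//y]\\x≡y g l)) Nl

    T₄-fills : FillsLayers 4F
    T₄-fills g {z} z≢ε = coset-point (Xᵗ.misses-every-coset (proj₁ (Φ.φ-≢ε z≢ε)) N-l₀ l₀≢ε g)
      where
      coset-point : (Σ G.Carrier λ l → N l ≡ true × X (proj₁ (Φ.φ-≢ε z≢ε)) (g G.// l) ≡ false) →
                    Σ G.Carrier λ h → T 4F (h , z) ≡ true × N (h G.\\ g) ≡ true
      coset-point (l , Nl , ¬X-g//l) =
        g G.// l , T₄-intro (proj₂ (Φ.φ-≢ε z≢ε)) z≢ε ¬X-g//l , subst (λ y → N y ≡ true) (sym (G.[x//y]\\x≡y g l)) Nl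

    ·K-at : ∀ (B : Sub H) i {g z h} → B (h G.\\ g , U.e) ≡ true → T i (h , z) ≡ true → _·K_ H (T i) B (g , z) ≡ true
    ·K-at B i {g} {z} {h} B-k T-hz =
      H.·K-intro (T i) B B-k (subst (λ x → T i x ≡ true) (sym (cong₂ _,_ (G.x//[y\\x]≡y g h) (U.x//ε≡x z))) T-hz)

    ·K-within-layer : ∀ (B : Sub H) → _⊆ˢ_ H B K → ∀ i {g z} → _·K_ H (T i) B (g , z) ≡ true →
                      Σ G.Carrier λ a → B (a , U.e) ≡ true × T i (g G.// a , z) ≡ true
    ·K-within-layer B B⊆K i {g} {z} TB-gz with H.·K-elim (T i) B TB-gz
    ... | (a , u) , B-au , T-gz//au with ⌊≟⌋-true⁻ U._≟_ (B⊆K (a , u) B-au)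
    ...   | refl = a , B-au , subst (λ x → T i x ≡ true) (cong (g G.// a ,_) (U.x//ε≡x z)) T-gz//au

    QK QL : Fin 5 → Sub H
    QK i = _·K_ H (T i) K
    QL i = _·K_ H (T i) L

    QK-layer₀ : ∀ i → Layer₀ i → ∀ {h₀} → T i (h₀ , U.e) ≡ true → ∀ x → QK i x ≡ K x
    QK-layer₀ i layer₀ T-h₀e (g , z) = T⇔T⇒≡
      (λ QK-gz → subst (λ y → ⌊ y U.≟ U.e ⌋ ≡ true)
                       (sym (layer₀ (proj₂ (proj₂ (·K-within-layer K (λ _ K-x → K-x) i QK-gz))))) ⌊ε≟ε⌋)
      (λ K-gz → subst (λ y → QK i (g , y) ≡ true) (sym (⌊≟⌋-true⁻ U._≟_ K-gz)) (·K-at K i ⌊ε≟ε⌋ T-h₀e))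

    QK-layer* : ∀ i → Layer* i → FillsLayers i → ∀ x → QK i x ≡ not (K x)
    QK-layer* i layer* fills (g , z) = T⇔T⇒≡
      (λ QK-gz → cong not (⌊≟⌋-≢ U._≟_ (layer* (proj₂ (proj₂ (·K-within-layer K (λ _ K-x → K-x) i QK-gz))))))
      (λ ¬K-gz → ·K-at K i ⌊ε≟ε⌋ (proj₁ (proj₂ (fills g (⌊≟⌋-false⁻ U._≟_ ¬K-gz)))))

    QL-layer₀ : ∀ i → _⊆ˢ_ H (T i) L → ∀ {h₀} → N h₀ ≡ true → T i (h₀ , U.e) ≡ true → ∀ x → QL i x ≡ L x
    QL-layer₀ i T⊆L {h₀} N-h₀ T-h₀e (g , z) = T⇔T⇒≡ forward backward
      where
      forward : QL i (g , z) ≡ true → L (g , z) ≡ true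
      forward QL-gz with ·K-within-layer L L⊆K i QL-gz
      ... | a , L-ae , T-g//a,z with ∧-true⁻ {N (g G.// a)} (T⊆L _ T-g//a,z)
      ...   | N-g//a , z≟ε =
        cong₂ _∧_ (subst (λ y → N y ≡ true) (G.//-rightDividesˡ a g) (R.N-∙ _ a N-g//a (proj₁ (∧-true⁻ L-ae)))) z≟ε
      backward : L (g , z) ≡ true → QL i (g , z) ≡ true
      backward L-gz with ∧-true⁻ {N g} L-gz
      ... | Ng , z≟ε = subst (λ y → QL i (g , y) ≡ true) (sym (⌊≟⌋-true⁻ U._≟_ z≟ε))
                         (·K-at L i (cong₂ _∧_ (R.N-\\ h₀ g N-h₀ Ng) ⌊ε≟ε⌋) T-h₀e)

    QL-T₂ : ∀ x → QL 2F x ≡ T 2F x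
    QL-T₂ (g , z) = T⇔T⇒≡ forward backward
      where
      forward : QL 2F (g , z) ≡ true → T 2F (g , z) ≡ true
      forward QL-gz with ·K-within-layer L L⊆K 2F QL-gz
      ... | a , L-ae , T₂-g//a,z with ∧-true⁻ {not (N (g G.// a))} T₂-g//a,z
      ...   | ¬N-g//a , z≟ε = cong₂ _∧_ (cong not N-g≡false) z≟ε
        where
        N-g≡false : N g ≡ false
        N-g≡false with N g in Ng
        ... | false = refl
        ... | true with trans (cong not (sym (R.N-// g a Ng (proj₁ (∧-true⁻ L-ae))))) ¬N-g//a
        ...   | ()
      backward : T 2F (g , z) ≡ true → QL 2F (g , z) ≡ true
      backward T₂-gz = ·K-at L 2F (cong₂ _∧_ (subst (λ y → N y ≡ true) (sym (G.inverseˡ g)) R.N-ε) ⌊ε≟ε⌋) T₂-gz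

    QL-layer* : ∀ i → Layer* i → FillsLayers i → ∀ x → QL i x ≡ not (K x)
    QL-layer* i layer* fills (g , z) = T⇔T⇒≡
      (λ QL-gz → cong not (⌊≟⌋-≢ U._≟_ (layer* (proj₂ (proj₂ (·K-within-layer L L⊆K i QL-gz))))))
      (λ ¬K-gz → let h , T-hz , N-h\g = fills g (⌊≟⌋-false⁻ U._≟_ ¬K-gz)
                 in ·K-at L i (cong₂ _∧_ N-h\g ⌊ε≟ε⌋) T-hz)

    distinct-map-allFinL5≡2 : ∀ (A : Fin 5 → Sub H) →
      eqSubᵇ H (A 0F) (A 1F) ≡ true → eqSubᵇ H (A 1F) (A 2F) ≡ true → eqSubᵇ H (A 2F) (A 3F) ≡ false →
      eqSubᵇ H (A 2F) (A 4F) ≡ false → eqSubᵇ H (A 3F) (A 4F) ≡ true →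
      distinct H (map A (allFinL 5)) ≡ 2
    distinct-map-allFinL5≡2 A e₀₁ e₁₂ e₂₃ e₂₄ e₃₄ rewrite e₀₁ | e₁₂ | e₂₃ | e₂₄ | e₃₄ = refl

    distinct-map-allFinL5≡3 : ∀ (A : Fin 5 → Sub H) →
      eqSubᵇ H (A 0F) (A 1F) ≡ true → eqSubᵇ H (A 1F) (A 2F) ≡ false → eqSubᵇ H (A 1F) (A 3F) ≡ false →
      eqSubᵇ H (A 1F) (A 4F) ≡ false → eqSubᵇ H (A 2F) (A 3F) ≡ false → eqSubᵇ H (A 2F) (A 4F) ≡ false →
      eqSubᵇ H (A 3F) (A 4F) ≡ true →
      distinct H (map A (allFinL 5)) ≡ 3
    distinct-map-allFinL5≡3 A e₀₁ e₁₂ e₁₃ e₁₄ e₂₃ e₂₄ e₃₄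
      rewrite e₀₁ | e₁₂ | e₁₃ | e₁₄ | e₂₃ | e₂₄ | e₃₄ = refl

    QK₀ : ∀ x → QK 0F x ≡ K x
    QK₀ = QK-layer₀ 0F (⊆K⇒layer₀ 0F (λ x → L⊆K x ∘ T₀⊆L x)) T₀-ε

    QK₁ : ∀ x → QK 1F x ≡ K x
    QK₁ = QK-layer₀ 1F (⊆K⇒layer₀ 1F (λ x → L⊆K x ∘ T₁⊆L x)) T₁-l₀

    QK₂ : ∀ x → QK 2F x ≡ K x
    QK₂ = QK-layer₀ 2F (⊆K⇒layer₀ 2F T₂⊆K) T₂-g₂

    QK₃ : ∀ x → QK 3F x ≡ not (K x)
    QK₃ = QK-layer* 3F T₃-layer* T₃-fills

    QK₄ : ∀ x → QK 4F x ≡ not (K x)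
    QK₄ = QK-layer* 4F T₄-layer* T₄-fills

    QL₀ : ∀ x → QL 0F x ≡ L x
    QL₀ = QL-layer₀ 0F T₀⊆L R.N-ε T₀-ε

    QL₁ : ∀ x → QL 1F x ≡ L x
    QL₁ = QL-layer₀ 1F T₁⊆L N-l₀ T₁-l₀

    QL₃ : ∀ x → QL 3F x ≡ not (K x)
    QL₃ = QL-layer* 3F T₃-layer* T₃-fills

    QL₄ : ∀ x → QL 4F x ≡ not (K x)
    QL₄ = QL-layer* 4F T₄-layer* T₄-fills

    rankQuot-K : rankQuot H T K ≡ 2
    rankQuot-K = distinct-map-allFinL5≡2 QK
      (H.eqSubᵇ-true (QK 0F) (QK 1F) (λ x → trans (QK₀ x) (sym (QK₁ x))))
      (H.eqSubᵇ-true (QK 1F) (QK 2F) (λ x → trans (QK₁ x) (sym (QK₂ x))))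
      (H.eqSubᵇ-false (QK 2F) (QK 3F) (trans (QK₂ H.e) ⌊ε≟ε⌋) (trans (QK₃ H.e) (cong not ⌊ε≟ε⌋)))
      (H.eqSubᵇ-false (QK 2F) (QK 4F) (trans (QK₂ H.e) ⌊ε≟ε⌋) (trans (QK₄ H.e) (cong not ⌊ε≟ε⌋)))
      (H.eqSubᵇ-true (QK 3F) (QK 4F) (λ x → trans (QK₃ x) (sym (QK₄ x))))

    rankQuot-L : rankQuot H T L ≡ 3
    rankQuot-L = distinct-map-allFinL5≡3 QL
      (H.eqSubᵇ-true (QL 0F) (QL 1F) (λ x → trans (QL₀ x) (sym (QL₁ x))))
      (H.eqSubᵇ-false (QL 1F) (QL 2F) (trans (QL₁ H.e) L-ε)
                                      (trans (QL-T₂ H.e) (cong (_∧ ⌊ U.e U.≟ U.e ⌋) (cong not R.N-ε))))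
      (H.eqSubᵇ-false (QL 1F) (QL 3F) (trans (QL₁ H.e) L-ε) (trans (QL₃ H.e) (cong not ⌊ε≟ε⌋)))
      (H.eqSubᵇ-false (QL 1F) (QL 4F) (trans (QL₁ H.e) L-ε) (trans (QL₄ H.e) (cong not ⌊ε≟ε⌋)))
      (H.eqSubᵇ-false (QL 2F) (QL 3F) (trans (QL-T₂ _) T₂-g₂) (trans (QL₃ (g₂ , U.e)) (cong not ⌊ε≟ε⌋)))
      (H.eqSubᵇ-false (QL 2F) (QL 4F) (trans (QL-T₂ _) T₂-g₂) (trans (QL₄ (g₂ , U.e)) (cong not ⌊ε≟ε⌋)))
      (H.eqSubᵇ-true (QL 3F) (QL 4F) (λ x → trans (QL₃ x) (sym (QL₄ x))))
      where
      L-ε : L H.e ≡ true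
      L-ε = cong₂ _∧_ R.N-ε ⌊ε≟ε⌋

    ∑-const : ∀ c → G.∑ (λ _ → c) ≡ c * ∣G∣
    ∑-const c = trans (sumℤ-cong G.elems (λ _ → sym (ℤₚ.*-identityʳ c)))
                      (trans (sumℤ-*ˡ G.elems c G.𝟙) (cong (c *_) R.∑𝟙))

    ∣H∣≡ : + ∣H∣ H ≡ + suc w * ∣G∣
    ∣H∣≡ = begin
      + ∣H∣ H                                          ≡⟨ count-by-layers (λ _ → true) ⟩
      sumℤ (λ u → G.∑ (λ _ → + 1)) U.elems             ≡⟨ sumℤ-cong U.elems (λ _ → trans (∑-const (+ 1)) (ℤₚ.*-identityˡ ∣G∣)) ⟩
      sumℤ (λ _ → ∣G∣) U.elems                         ≡⟨ sumℤ-cong U.elems (λ _ → sym (ℤₚ.*-identityˡ ∣G∣)) ⟩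
      sumℤ (λ _ → + 1 * ∣G∣) U.elems                   ≡⟨ sumℤ-*ʳ U.elems ∣G∣ (λ _ → + 1) ⟩
      sumℤ (λ _ → + 1) U.elems * ∣G∣                   ≡⟨ cong (_* ∣G∣) (trans (sumℤ-one U.elems) (cong +_ ∣U∣≡)) ⟩
      + suc w * ∣G∣                                    ∎
      where open ≡-Reasoning
            ∣U∣≡ = Φ.∣U∣≡ W-complete W-unique ∣W∣≡w

    ∣K∣≡ : + ∣_∣ˢ H K ≡ ∣G∣
    ∣K∣≡ = trans (count-by-layers K)
             (trans (sumℤ-cong U.elems (λ u → ∑-const (δ₀ u))) (U.sumℤ-δ U.unique (U.complete U.e) (λ _ → ∣G∣)))

    ∣L∣≡ : + ∣_∣ˢ H L ≡ + n
    ∣L∣≡ = trans (count-by-layers L) (trans (sumℤ-cong U.elems layer)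
             (trans (U.sumℤ-δ U.unique (U.complete U.e) (λ _ → G.∑ R.𝟙N)) R.∑𝟙N))
      where
      layer : ∀ u → G.∑ (λ g → ⟦ L (g , u) ⟧) ≡ δ₀ u * G.∑ R.𝟙N
      layer u = trans (sumℤ-cong G.elems (λ g → trans (sym (⟦⟧-∧ (N g) _)) (ℤₚ.*-comm ⟦ N g ⟧ (δ₀ u))))
                      (sumℤ-*ˡ G.elems (δ₀ u) R.𝟙N)

    T₃-layer : ∀ u → G.∑ (λ g → ⟦ T 3F (g , u) ⟧) ≡ δ* u * nλ
    T₃-layer u = trans (sumℤ-cong G.elems (λ g → 𝟙T₃ (g , u)))
                       (trans (sumℤ-*ˡ G.elems (δ* u) (Xφ u)) (δ*-*-cong u ∑Xφ))

    T₄-layer : ∀ u → G.∑ (λ g → ⟦ T 4F (g , u) ⟧) ≡ δ* u * (nλ * (+ n - + 1))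
    T₄-layer u = begin
      G.∑ (λ g → ⟦ T 4F (g , u) ⟧)
        ≡⟨ sumℤ-cong G.elems (λ g → trans (𝟙T₄ (g , u)) (sym (*-distribˡ-- (δ* u) (+ 1) (Xφ u g)))) ⟩
      G.∑ (λ g → δ* u * (+ 1 - Xφ u g))              ≡⟨ sumℤ-*ˡ G.elems (δ* u) _ ⟩
      δ* u * G.∑ (λ g → + 1 - Xφ u g)                ≡⟨ δ*-*-cong u ∑G∖Xφ ⟩
      δ* u * (nλ * (+ n - + 1))                      ∎
      where
      open ≡-Reasoning
      ∑G∖Xφ : u ≢ U.e → G.∑ (λ g → + 1 - Xφ u g) ≡ nλ * (+ n - + 1)
      ∑G∖Xφ u≢ε = trans (sumℤ-- G.elems G.𝟙 (Xφ u)) (trans (cong₂ _-_ R.∑𝟙 (∑Xφ u≢ε)) ∣G∣-nλ≡nλ[n-1])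

    ∣T₃∣≡ : + ∣_∣ˢ H (T 3F) ≡ + w * nλ
    ∣T₃∣≡ = trans (count-by-layers (T 3F))
              (trans (sumℤ-cong U.elems T₃-layer) (trans (sumℤ-*ʳ U.elems nλ δ*) (cong (_* nλ) ∑δ*)))

    ∣T₄∣≡ : + ∣_∣ˢ H (T 4F) ≡ + w * (nλ * (+ n - + 1))
    ∣T₄∣≡ = trans (count-by-layers (T 4F))
              (trans (sumℤ-cong U.elems T₄-layer) (trans (sumℤ-*ʳ U.elems _ δ*) (cong (_* _) ∑δ*)))

    ∣T₄∩Kx∣≡ : ∀ x → K x ≡ false → + ∣_∣ˢ H (_∩ˢ_ H (T 4F) (coset H K x)) ≡ nλ * (+ n - + 1)
    ∣T₄∩Kx∣≡ (a , u) ¬K-au = begin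
      + ∣_∣ˢ H (_∩ˢ_ H (T 4F) (coset H K (a , u)))              ≡⟨ count-by-layers _ ⟩
      sumℤ (λ v → G.∑ (λ g → ⟦ T 4F (g , v) ∧ ⌊ (v U.// u) U.≟ U.e ⌋ ⟧)) U.elems
        ≡⟨ sumℤ-cong U.elems (λ v → trans (sumℤ-cong G.elems (λ g → in-coset g v)) (sumℤ-*ˡ G.elems (U.δ u v) _)) ⟩
      sumℤ (λ v → U.δ u v * G.∑ (λ g → ⟦ T 4F (g , v) ⟧)) U.elems
        ≡⟨ U.sumℤ-δ U.unique (U.complete u) (λ v → G.∑ (λ g → ⟦ T 4F (g , v) ⟧)) ⟩
      G.∑ (λ g → ⟦ T 4F (g , u) ⟧)                               ≡⟨ T₄-layer u ⟩
      δ* u * (nλ * (+ n - + 1))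
        ≡⟨ cong (λ d → (+ 1 - d) * (nλ * (+ n - + 1))) (U.δ-≢ (⌊≟⌋-false⁻ U._≟_ (cong not ¬K-au))) ⟩
      + 1 * (nλ * (+ n - + 1))                                   ≡⟨ ℤₚ.*-identityˡ _ ⟩
      nλ * (+ n - + 1)                                           ∎
      where
      open ≡-Reasoning
      in-coset : ∀ g v → ⟦ T 4F (g , v) ∧ ⌊ (v U.// u) U.≟ U.e ⌋ ⟧ ≡ U.δ u v * ⟦ T 4F (g , v) ⟧
      in-coset g v = trans (sym (⟦⟧-∧ (T 4F (g , v)) _))
                           (trans (cong (⟦ T 4F (g , v) ⟧ *_) (U.δₑ-// v u)) (ℤₚ.*-comm ⟦ T 4F (g , v) ⟧ (U.δ u v)))

    lin-at-block : ∀ (c : Fin 5 → ℤ) {k x} → T k x ≡ true → lin H c T x ≡ c k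
    lin-at-block c {k} {x} Tₖx =
      trans (sumℤ-cong (allFinL 5) (λ i → trans (cong (λ b → c i * ⟦ b ⟧) (T≡ i)) (ℤₚ.*-comm (c i) _)))
            (F5.sumℤ-δ (allFinL-unique 5) (∈-allFinL k) c)
      where
      T≡ : ∀ i → T i x ≡ ⌊ i Fin.≟ k ⌋
      T≡ i = T⇔T⇒≡ (λ Tᵢx → subst (λ j → ⌊ j Fin.≟ k ⌋ ≡ true) (sym (proj₂ (proj₂ partition) x i k Tᵢx Tₖx))
                                  (⌊≟⌋-refl Fin._≟_ k))
                   (λ i≟k → subst (λ j → T j x ≡ true) (sym (⌊≟⌋-true⁻ Fin._≟_ i≟k)) Tₖx)

    𝟙T₃⋆𝟙T₄-at-g₃z₃ : (𝟙T 3F H.⋆ 𝟙T 4F) (g₃ , z₃) ≡ (+ n - + 1) * (+ w - + 1) * + ν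
    𝟙T₃⋆𝟙T₄-at-g₃z₃ = begin
      (𝟙T 3F H.⋆ 𝟙T 4F) (g₃ , z₃)                          ≡⟨ H.⋆-cong 𝟙T₃ 𝟙T₄ (g₃ , z₃) ⟩
      (X* H.⋆ (λ y → G* y - X* y)) (g₃ , z₃)               ≡⟨ H.⋆-distribˡ-- X* G* X* (g₃ , z₃) ⟩
      (X* H.⋆ G*) (g₃ , z₃) - (X* H.⋆ X*) (g₃ , z₃)        ≡⟨ cong₂ _-_ (X*⋆G* g₃ z₃) (X*⋆X*-layer* g₃ φ-z₃) ⟩
      value (δ₀ z₃) (X α₀ g₃) nλ                            ≡⟨ cong₂ (λ d b → value d b nλ) (U.δ-≢ z₃≢ε) X-g₃ ⟩
      value (+ 0) true nλ                                   ≡⟨ cong (value (+ 0) true) nλ≡μ+ν[n-1] ⟩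
      value (+ 0) true (+ μ + + ν * (+ n - + 1))            ≡⟨ simplify (+ w) (+ μ) (+ ν) (+ n - + 1) ⟩
      (+ n - + 1) * (+ w - + 1) * + ν                       ∎
      where
      open ≡-Reasoning
      value : ℤ → Bool → ℤ → ℤ
      value d b a = (+ w * a) * (d * + 1) + ((+ w - + 1) * a) * ((+ 1 - d) * + 1)
                    - (+ w - + 1) * (+ μ * ⟦ b ⟧ + + ν * ⟦ not b ⟧)
      simplify : ∀ v m k c → (v * (m + k * c)) * (+ 0 * + 1) + ((v - + 1) * (m + k * c)) * ((+ 1 - + 0) * + 1)
                             - (v - + 1) * (m * + 1 + k * + 0) ≡ c * (v - + 1) * k
      simplify = solve-∀

    t-parameter : Σ (Fin 5 → ℤ) λ p → _≈ᴿ_ H (_⊛_ H (ul H (T 3F)) (ul H (T 4F))) (lin H p T)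
                                     × p 3F ≡ + ((n ℕ.∸ 1) ℕ.* (w ℕ.∸ 1) ℕ.* ν)
    t-parameter = p , T₃⋆T₄≈p , (begin
      p 3F                                          ≡⟨ lin-at-block p {3F} T₃-g₃ ⟨
      lin H p T (g₃ , z₃)                           ≡⟨ T₃⋆T₄≈p (g₃ , z₃) ⟨
      (𝟙T 3F H.⋆ 𝟙T 4F) (g₃ , z₃)                   ≡⟨ 𝟙T₃⋆𝟙T₄-at-g₃z₃ ⟩
      (+ n - + 1) * (+ w - + 1) * + ν
        ≡⟨ cong₂ (λ a b → a * b * + ν) (+[m∸1]≡+m-1 1≤n) (+[m∸1]≡+m-1 (ℕₚ.≤-trans (ℕ.s≤s ℕ.z≤n) 2≤w)) ⟨
      + (n ℕ.∸ 1) * + (w ℕ.∸ 1) * + ν               ≡⟨ cong (_* + ν) (ℤₚ.pos-* (n ℕ.∸ 1) (w ℕ.∸ 1)) ⟨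
      + ((n ℕ.∸ 1) ℕ.* (w ℕ.∸ 1)) * + ν             ≡⟨ ℤₚ.pos-* ((n ℕ.∸ 1) ℕ.* (w ℕ.∸ 1)) ν ⟨
      + ((n ℕ.∸ 1) ℕ.* (w ℕ.∸ 1) ℕ.* ν)             ∎)
      where
      open ≡-Reasoning
      p = proj₁ (spanned-𝟙T⋆𝟙T 3F 4F)
      T₃⋆T₄≈p = proj₂ (spanned-𝟙T⋆𝟙T 3F 4F)

    +nλ[n-1] : + (n ℕ.* λ' ℕ.* (n ℕ.∸ 1)) ≡ nλ * (+ n - + 1)
    +nλ[n-1] = trans (ℤₚ.pos-* (n ℕ.* λ') (n ℕ.∸ 1)) (cong (nλ *_) (+[m∸1]≡+m-1 1≤n))

    k-parameter : ∀ x → K x ≡ false → ∣_∣ˢ H (_∩ˢ_ H (T 4F) (coset H K x)) ≡ n ℕ.* λ' ℕ.* (n ℕ.∸ 1)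
    k-parameter x ¬Kx = ℤₚ.+-injective (trans (∣T₄∩Kx∣≡ x ¬Kx) (sym +nλ[n-1]))

    ∣T₃∣≤∣T₄∣ : ∣_∣ˢ H (T 3F) ℕ.≤ ∣_∣ˢ H (T 4F)
    ∣T₃∣≤∣T₄∣ = subst₂ ℕ._≤_ (sym ∣T₃∣≡ℕ) (sym ∣T₄∣≡ℕ)
                  (ℕₚ.*-monoʳ-≤ w (ℕₚ.m≤m*n (n ℕ.* λ') (n ℕ.∸ 1) {{ℕ.>-nonZero (ℕₚ.∸-monoˡ-≤ 1 2≤n)}}))
      where
      ∣T₃∣≡ℕ : ∣_∣ˢ H (T 3F) ≡ w ℕ.* (n ℕ.* λ')
      ∣T₃∣≡ℕ = ℤₚ.+-injective (trans ∣T₃∣≡ (sym (ℤₚ.pos-* w (n ℕ.* λ'))))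
      ∣T₄∣≡ℕ : ∣_∣ˢ H (T 4F) ≡ w ℕ.* (n ℕ.* λ' ℕ.* (n ℕ.∸ 1))
      ∣T₄∣≡ℕ = ℤₚ.+-injective (trans ∣T₄∣≡ (sym (trans (ℤₚ.pos-* w _) (cong (+ w *_) +nλ[n-1]))))

    ∣L∣≡n : ∣_∣ˢ H L ≡ n
    ∣L∣≡n = ℤₚ.+-injective ∣L∣≡

    index-K : (w ℕ.+ 1) ℕ.* ∣_∣ˢ H K ≡ ∣H∣ H
    index-K = ℤₚ.+-injective (begin
      + ((w ℕ.+ 1) ℕ.* ∣_∣ˢ H K)        ≡⟨ ℤₚ.pos-* (w ℕ.+ 1) _ ⟩
      + (w ℕ.+ 1) * + ∣_∣ˢ H K          ≡⟨ cong₂ _*_ (cong +_ (ℕₚ.+-comm w 1)) ∣K∣≡ ⟩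
      + suc w * ∣G∣                     ≡⟨ ∣H∣≡ ⟨
      + ∣H∣ H                           ∎)
      where open ≡-Reasoning

    index-L : n ℕ.* λ' ℕ.* ∣_∣ˢ H L ≡ ∣_∣ˢ H K
    index-L = trans (cong (n ℕ.* λ' ℕ.*_) ∣L∣≡n) (sym (ℤₚ.+-injective ∣K∣≡))


open import Defs
open import Data.Nat using (ℕ; _+_; _*_; _∸_; _≤_)
open import Data.Integer using (+_)
open import Data.List using (List)
open import Data.Maybe using (Maybe)
open import Data.Product using (_×_)
open import Relation.Binary.PropositionalEquality using (_≡_; _≢_)
open import Relation.Binary.Definitions using (DecidableEquality)
open import Function.Definitions using (Bijective)
open import Data.Fin.Patterns using (3F; 4F)
open import Data.Product using (_,_)

open HigmanianSRing using (module Construction)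

proposition1 :
    (G U : FinGroup) →
    (W : Set) → (_≟W_ : DecidableEquality W) → (Welems : List W) →
    (N : Sub G) → (X : W → Sub G) →
    (χ : W → W) → (ψ : (α β : W) → .(β ≢ χ α) → W) →
    (n λ' w μ ν : ℕ) →
    2 ≤ n →
    IsClosedLinkedSystem G W _≟W_ Welems N X χ ψ (n * λ') n (n * λ') λ' w μ ν →
    (φ : FinGroup.Carrier U → Maybe W) →
    Bijective _≡_ _≡_ φ →
    (∀ u v → φ (FinGroup._∙_ U u v) ≡ ψ̂ _≟W_ χ ψ (φ u) (φ v)) →
    IsHigmanian (G ⊗ U) (Tset G U φ N X)
      (w + 1) (n * λ') n (n * λ' * (n ∸ 1)) (+ ((n ∸ 1) * (w ∸ 1) * ν))
proposition1 G U W _≟W_ Welems N X χ ψ n λ' w μ ν 2≤n linked φ φ-bijective φ-hom =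
  isSRing , symmetric , L , K , L-proper , K-proper , L⊆K , K∖L , spanned-L , spanned-K ,
  rank-L , rankQuot-K , rankQuot-L , rank-K ,
  4F , 3F , (λ ()) , H.subsetᵇ-false (T 4F) K T₄-g₄ ⌊z₃≟ε⌋ , H.subsetᵇ-false (T 3F) K T₃-g₃ ⌊z₃≟ε⌋ ,
  ∣T₃∣≤∣T₄∣ , index-K , index-L , ∣L∣≡n , k-parameter , t-parameter
  where open Construction G U W _≟W_ Welems N X χ ψ n λ' w μ ν 2≤n linked φ φ-bijective φ-hom
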